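{- Let $\ell\ge 5$. Start with the wheel $C_4\vee K_1$ with rim cycle $(w_1,w_2,w_3,w_4,w_1)$ and hub $w_0$ adjacent to $w_1,\dots,w_4$. (a) If $\ell\ge 6$: add a path $(v_1,\dots,v_{\ell-3})$ on new vertices; join $w_1$ to each of $v_1,\dots,v_{\ell-4}$; join $v_{\ell-5}$ to $v_{\ell-3}$; join $w_2$ to $v_1$ and $w_3$ to $v_{\ell-3}$; join $w_4$ to $v_{\ell-4}$ and $v_{\ell-3}$; add a new vertex $z$ adjacent to $w_1,w_4,v_{\ell-4}$. (b) If $\ell=5$: add new adjacent vertices $v_1,v_2$; join $w_1$ to $v_1$; join $w_2$ to $v_1$ and $v_2$; join $w_3$ to $v_2$; join $w_4$ to $v_1$ and $v_2$; add new vertices $z_1$ adjacent to $v_1,w_1,w_4$ and $z_2$ adjacent to $v_2,w_2,w_3$. Let $\overline{G}$ be the resulting graph and $G$ its complement. Then $\mathcal{I}(G)\cong\theta_{2,2,\ell}$.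
   Context: For a graph $G$, an $i$-set is an independent dominating set of minimum cardinality. The $i$-graph $\mathcal{I}(G)$ has the $i$-sets as vertices, with $X\sim Y$ iff $Y=(X\setminus\{u\})\cup\{v\}$ for some $u\in X$, $v\notin X$ with $uv\in E(G)$. $\theta_{j,k,\ell}$ denotes two vertices joined by three internally vertex-disjoint paths of lengths $j,k,\ell$. -}

module Defs where

open import Data.Bool using (Bool; true; false; not; _∧_; _∨_; T)
open import Data.Nat using (ℕ; zero; suc; _+_; _≤_; _≡ᵇ_; pred)
open import Data.Fin using (Fin; toℕ)
open import Data.Fin.Subset using (Subset; _∈_; _∉_; ∣_∣; _-_; _∪_; ⁅_⁆)
open import Data.List using (List; []; _∷_; _++_; map; upTo)
open import Data.Bool.ListAction using (any)
open import Data.Product using (Σ; _×_; _,_; ∃; ∃-syntax)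
open import Data.Sum using (_⊎_)
open import Relation.Nullary using (¬_)
open import Relation.Binary.PropositionalEquality using (_≡_)
open import Function.Bundles using (_⇔_)

record Graph (n : ℕ) : Set where
  field
    adj : Fin n → Fin n → Bool

open Graph public

fromEdges : (n : ℕ) → List (ℕ × ℕ) → Graph n
fromEdges n es .adj u v =
  any (λ { (a , b) → ((toℕ u ≡ᵇ a) ∧ (toℕ v ≡ᵇ b)) ∨ ((toℕ u ≡ᵇ b) ∧ (toℕ v ≡ᵇ a)) }) es

complement : ∀ {n} → Graph n → Graph n
complement G .adj u v = not (adj G u v) ∧ not (toℕ u ≡ᵇ toℕ v)

Adj : ∀ {n} → Graph n → Fin n → Fin n → Set
Adj G u v = T (adj G u v)

Independent : ∀ {n} → Graph n → Subset n → Set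
Independent G X = ∀ u v → u ∈ X → v ∈ X → ¬ Adj G u v

Dominating : ∀ {n} → Graph n → Subset n → Set
Dominating G X = ∀ v → v ∈ X ⊎ (∃[ u ] (u ∈ X × Adj G u v))

IndepDom : ∀ {n} → Graph n → Subset n → Set
IndepDom G X = Independent G X × Dominating G X

ISet : ∀ {n} → Graph n → Subset n → Set
ISet G X = IndepDom G X × (∀ Y → IndepDom G Y → ∣ X ∣ ≤ ∣ Y ∣)

ISwap : ∀ {n} → Graph n → Subset n → Subset n → Set
ISwap G X Y = ∃[ u ] ∃[ v ] (u ∈ X × v ∉ X × Adj G u v × Y ≡ ((X - u) ∪ ⁅ v ⁆))

record AbsGraph : Set₁ where
  field
    V : Set
    E : V → V → Set

open AbsGraph public

IGraphIso : ∀ {n} → Graph n → AbsGraph → Set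
IGraphIso {n} G H =
  Σ (V H → Subset n) λ φ →
      (∀ x → ISet G (φ x))
    × (∀ x y → φ x ≡ φ y → x ≡ y)
    × (∀ X → ISet G X → ∃[ x ] (φ x ≡ X))
    × (∀ x y → E H x y ⇔ ISwap G (φ x) (φ y))

-- Theta graphs θ_{j,k,l}: end vertices a, b joined by three internally
-- disjoint paths of lengths len 0 = j, len 1 = k, len 2 = l.

lenθ : ℕ → ℕ → ℕ → Fin 3 → ℕ
lenθ j k l Fin.zero = j
lenθ j k l (Fin.suc Fin.zero) = k
lenθ j k l (Fin.suc (Fin.suc Fin.zero)) = l

data ThetaV (j k l : ℕ) : Set where
  endA endB : ThetaV j k l
  -- internal vertex number (suc t) on path i, 1 ≤ suc t ≤ len i - 1
  inner : (i : Fin 3) → Fin (pred (lenθ j k l i)) → ThetaV j k l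

data OnPath {j k l : ℕ} (i : Fin 3) : ThetaV j k l → ℕ → Set where
  atA : OnPath i endA 0
  atB : OnPath i endB (lenθ j k l i)
  atInner : (t : Fin (pred (lenθ j k l i))) → OnPath i (inner i t) (suc (toℕ t))

θ : ℕ → ℕ → ℕ → AbsGraph
θ j k l .V = ThetaV j k l
θ j k l .E x y =
  ∃[ i ] ∃[ s ] ∃[ t ] (OnPath i x s × OnPath i y t × (suc s ≡ t ⊎ suc t ≡ s))

-- The graphs Ḡ of the theorem. Vertex numbering:
--   w₀,…,w₄ ↦ 0,…,4 ;  v_i ↦ 4 + i ;  then z (case a) or z₁, z₂ (case b).

wheelEdges : List (ℕ × ℕ)
wheelEdges = (1 , 2) ∷ (2 , 3) ∷ (3 , 4) ∷ (4 , 1)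
           ∷ (0 , 1) ∷ (0 , 2) ∷ (0 , 3) ∷ (0 , 4) ∷ []

-- Case (a), ℓ = 6 + k ≥ 6.  Vertices: w₀..w₄ = 0..4, v₁..v_{ℓ-3} = 5..k+7,
-- z = k+8; total ℓ + 3 = k + 9 vertices.
--   path v₁…v_{ℓ-3}: (5+j, 6+j) for j < ℓ-4 = k+2
--   w₁ v_i for i ≤ ℓ-4: (1, 5+j) for j < k+2
--   v_{ℓ-5} v_{ℓ-3} = (k+5, k+7); w₂v₁ = (2,5); w₃v_{ℓ-3} = (3, k+7);
--   w₄v_{ℓ-4} = (4, k+6); w₄v_{ℓ-3} = (4, k+7); z w₁, z w₄, z v_{ℓ-4}.
Gbar-a : (k : ℕ) → Graph (k + 9)
Gbar-a k = fromEdges (k + 9)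
  ( wheelEdges
  ++ map (λ j → (5 + j , 6 + j)) (upTo (k + 2))
  ++ map (λ j → (1 , 5 + j)) (upTo (k + 2))
  ++ (k + 5 , k + 7) ∷ (2 , 5) ∷ (3 , k + 7) ∷ (4 , k + 6) ∷ (4 , k + 7)
  ∷ (k + 8 , 1) ∷ (k + 8 , 4) ∷ (k + 8 , k + 6) ∷ [])

-- Case (b), ℓ = 5.  Vertices: w₀..w₄ = 0..4, v₁ = 5, v₂ = 6, z₁ = 7, z₂ = 8.
Gbar-b : Graph 9
Gbar-b = fromEdges 9
  ( wheelEdges
  ++ (5 , 6) ∷ (1 , 5) ∷ (2 , 5) ∷ (2 , 6) ∷ (3 , 6) ∷ (4 , 5) ∷ (4 , 6)
  ∷ (7 , 5) ∷ (7 , 1) ∷ (7 , 4) ∷ (8 , 6) ∷ (8 , 2) ∷ (8 , 3) ∷ [])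

-- An independent dominating set of the complement G of Ḡ is a maximal clique of Ḡ. Every
-- vertex of Ḡ lies on an edge and every edge on a triangle, so i-sets have at least three
-- elements; the only K₄ of Ḡ is {w₁, w₄, v_{ℓ-4}, z} (for ℓ ≥ 6), so the i-sets are exactly the
-- ℓ + 3 triangles of Ḡ that lie in no K₄. Two such triangles are adjacent in 𝓘(G) iff they share
-- an edge, and the shared edges arrange them as θ₂,₂,ℓ: the ends w₀w₁w₂ and w₀w₃w₄ are joined
-- through w₀w₁w₄, through w₀w₂w₃, and through the fan w₁w₂v₁, w₁v₁v₂, …, w₁v_{ℓ-5}v_{ℓ-4}
-- followed by v_{ℓ-5}v_{ℓ-4}v_{ℓ-3}, w₄v_{ℓ-4}v_{ℓ-3}, w₃w₄v_{ℓ-3}.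
-- For ℓ = 5 the graph is fixed and everything is decided by computation.

module Submission where

open import Defs
open import Data.Bool using (true; false; not; T; _∧_; _∨_)
open import Data.Bool.Properties using (T-∧; T-∨) renaming (_≟_ to _≟ᵇ_)
open import Data.Empty using (⊥; ⊥-elim)
open import Data.Fin using (Fin; toℕ; fromℕ<; #_)
  renaming (zero to fzero; suc to fsuc; _<_ to _<ᶠ_; _≤_ to _≤ᶠ_)
import Data.Fin.Properties as Fin
open import Data.Fin.Properties using (toℕ-injective; toℕ-fromℕ<; toℕ<n) renaming (_≟_ to _≟ᶠ_)
open import Data.Fin.Subset using (Subset; _∈_; _∉_; _⊆_; ∣_∣; _-_; _∪_; ⁅_⁆; inside; outside)
open import Data.Fin.Subset.Properties
  using ( x∈⁅x⁆; x∈⁅y⁆⇒x≡y; ∣⁅x⁆∣≡1; x∈p∪q⁻; x∈p∪q⁺; ⊆-antisym; ∪-identityˡ; ∣p∣≤∣x∷p∣; p⊆q⇒∣p∣≤∣q∣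
        ; x∈p∧x≢y⇒x∈p-y; p─q⊆p; _∈?_; anySubset?)
open import Data.List using (List; []; _∷_; _++_; upTo)
import Data.List as List
open import Data.List.Relation.Unary.Any using (Any; here; there)
open import Data.List.Relation.Unary.Any.Properties using (++⁻; ++⁺ˡ; ++⁺ʳ; map⁻; map⁺; applyUpTo⁻; applyUpTo⁺)
open import Data.Nat using (ℕ; suc; _+_; _≤_; _<_; z≤n; s≤s; _≡ᵇ_; _≟_; _≤?_; _<?_)
open import Data.Nat.Properties
  using ( ≤-refl; ≤-reflexive; ≤-trans; ≤-pred; ≤-antisym; ≤-irrelevant; <⇒≤; <-trans; <-irrefl; <-asym
        ; n≤1+n; n<1+n; m≤n+m; +-monoʳ-≤; +-comm; n≮n; m+n≮n; m≤n⇒m<n∨m≡n; ≮⇒≥; ≰⇒>; pred[n]≤n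
        ; suc-injective; ≡ᵇ⇒≡; ≡⇒≡ᵇ)
open import Data.Product using (Σ; _×_; _,_; proj₁; proj₂; ∃; ∃-syntax) renaming (map to mapΣ)
import Data.Product as Product
open import Data.Sum using (_⊎_; inj₁; inj₂; [_,_]; swap)
import Data.Sum as Sum
open import Data.Vec using (_∷_; here; there)
open import Data.Vec.Properties using (≡-dec)
open import Function using (_∘_; id)
open import Function.Bundles using (_⇔_; mk⇔; Equivalence)
open import Relation.Nullary using (¬_; Dec; yes; no)
open import Relation.Nullary.Decidable
  using (map′; T?; ¬?; _×-dec_; _⊎-dec_; _→-dec_; toWitness; toWitnessFalse; decidable-stable)
open import Relation.Binary.PropositionalEquality using (_≡_; _≢_; refl; sym; trans; cong; subst; subst₂)

open Equivalence using (to; from)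

private variable
  n : ℕ

OneOf : {A : Set} → A → A → A → A → Set
OneOf w a b c = w ≡ a ⊎ w ≡ b ⊎ w ≡ c

triple : Fin n → Fin n → Fin n → Subset n
triple a b c = ⁅ a ⁆ ∪ ⁅ b ⁆ ∪ ⁅ c ⁆

module _ {a b c w : Fin n} where

  ∈-triple⁻ : w ∈ triple a b c → OneOf w a b c
  ∈-triple⁻ w∈ with x∈p∪q⁻ ⁅ a ⁆ (⁅ b ⁆ ∪ ⁅ c ⁆) w∈
  ... | inj₁ w∈a = inj₁ (x∈⁅y⁆⇒x≡y a w∈a)
  ... | inj₂ w∈bc with x∈p∪q⁻ ⁅ b ⁆ ⁅ c ⁆ w∈bc
  ...   | inj₁ w∈b = inj₂ (inj₁ (x∈⁅y⁆⇒x≡y b w∈b))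
  ...   | inj₂ w∈c = inj₂ (inj₂ (x∈⁅y⁆⇒x≡y c w∈c))

  ∈-triple⁺ : OneOf w a b c → w ∈ triple a b c
  ∈-triple⁺ (inj₁ refl)        = x∈p∪q⁺ (inj₁ (x∈⁅x⁆ a))
  ∈-triple⁺ (inj₂ (inj₁ refl)) = x∈p∪q⁺ (inj₂ (x∈p∪q⁺ (inj₁ (x∈⁅x⁆ b))))
  ∈-triple⁺ (inj₂ (inj₂ refl)) = x∈p∪q⁺ (inj₂ (x∈p∪q⁺ (inj₂ (x∈⁅x⁆ c))))

oneOf? : (w a b c : Fin n) → Dec (OneOf w a b c)
oneOf? w a b c with w ≟ᶠ a | w ≟ᶠ b | w ≟ᶠ c
... | yes e | _     | _     = yes (inj₁ e)
... | no _  | yes e | _     = yes (inj₂ (inj₁ e))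
... | no _  | no _  | yes e = yes (inj₂ (inj₂ e))
... | no ¬a | no ¬b | no ¬c = no λ { (inj₁ e) → ¬a e ; (inj₂ (inj₁ e)) → ¬b e ; (inj₂ (inj₂ e)) → ¬c e }

triple-ext : ∀ {a b c a′ b′ c′ : Fin n}
           → (∀ w → OneOf w a b c → OneOf w a′ b′ c′) → (∀ w → OneOf w a′ b′ c′ → OneOf w a b c)
           → triple a b c ≡ triple a′ b′ c′
triple-ext f g = ⊆-antisym (∈-triple⁺ ∘ f _ ∘ ∈-triple⁻) (∈-triple⁺ ∘ g _ ∘ ∈-triple⁻)

triple-swap₁₂ : (a b c : Fin n) → triple a b c ≡ triple b a c
triple-swap₁₂ a b c = triple-ext exchange exchange
  where
    exchange : ∀ {a b c : Fin n} w → OneOf w a b c → OneOf w b a c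
    exchange w (inj₁ e)        = inj₂ (inj₁ e)
    exchange w (inj₂ (inj₁ e)) = inj₁ e
    exchange w (inj₂ (inj₂ e)) = inj₂ (inj₂ e)

triple-rotate : (a b c : Fin n) → triple a b c ≡ triple c a b
triple-rotate a b c = triple-ext forward backward
  where
    forward : ∀ w → OneOf w a b c → OneOf w c a b
    forward w (inj₁ e)        = inj₂ (inj₁ e)
    forward w (inj₂ (inj₁ e)) = inj₂ (inj₂ e)
    forward w (inj₂ (inj₂ e)) = inj₁ e
    backward : ∀ w → OneOf w c a b → OneOf w a b c
    backward w (inj₁ e)        = inj₂ (inj₂ e)
    backward w (inj₂ (inj₁ e)) = inj₁ e
    backward w (inj₂ (inj₂ e)) = inj₂ (inj₁ e)

triple⊆ : ∀ {a b c} {Y : Subset n} → a ∈ Y → b ∈ Y → c ∈ Y → triple a b c ⊆ Y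
triple⊆ a∈ b∈ c∈ w∈ with ∈-triple⁻ w∈
... | inj₁ refl        = a∈
... | inj₂ (inj₁ refl) = b∈
... | inj₂ (inj₂ refl) = c∈

∣⁅x⁆∪p∣≤1+∣p∣ : (x : Fin n) (p : Subset n) → ∣ ⁅ x ⁆ ∪ p ∣ ≤ suc ∣ p ∣
∣⁅x⁆∪p∣≤1+∣p∣ fzero    (s ∷ p) rewrite ∪-identityˡ p = s≤s (∣p∣≤∣x∷p∣ s p)
∣⁅x⁆∪p∣≤1+∣p∣ (fsuc x) (inside  ∷ p) = s≤s (∣⁅x⁆∪p∣≤1+∣p∣ x p)
∣⁅x⁆∪p∣≤1+∣p∣ (fsuc x) (outside ∷ p) = ∣⁅x⁆∪p∣≤1+∣p∣ x p

x∉p⇒∣⁅x⁆∪p∣≡1+∣p∣ : (x : Fin n) (p : Subset n) → x ∉ p → ∣ ⁅ x ⁆ ∪ p ∣ ≡ suc ∣ p ∣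
x∉p⇒∣⁅x⁆∪p∣≡1+∣p∣ fzero    (outside ∷ p) _ rewrite ∪-identityˡ p = refl
x∉p⇒∣⁅x⁆∪p∣≡1+∣p∣ fzero    (inside  ∷ p) x∉ = ⊥-elim (x∉ here)
x∉p⇒∣⁅x⁆∪p∣≡1+∣p∣ (fsuc x) (inside  ∷ p) x∉ = cong suc (x∉p⇒∣⁅x⁆∪p∣≡1+∣p∣ x p (x∉ ∘ there))
x∉p⇒∣⁅x⁆∪p∣≡1+∣p∣ (fsuc x) (outside ∷ p) x∉ = x∉p⇒∣⁅x⁆∪p∣≡1+∣p∣ x p (x∉ ∘ there)

∣triple∣≤3 : (a b c : Fin n) → ∣ triple a b c ∣ ≤ 3
∣triple∣≤3 a b c = ≤-trans (∣⁅x⁆∪p∣≤1+∣p∣ a _)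
  (s≤s (≤-trans (∣⁅x⁆∪p∣≤1+∣p∣ b _) (s≤s (≤-reflexive (∣⁅x⁆∣≡1 c)))))

module _ {a b c : Fin n} (a≢b : a ≢ b) (a≢c : a ≢ c) (b≢c : b ≢ c) where

  ∣triple∣≡3 : ∣ triple a b c ∣ ≡ 3
  ∣triple∣≡3 = trans (x∉p⇒∣⁅x⁆∪p∣≡1+∣p∣ a _ a∉) (cong suc (trans
                 (x∉p⇒∣⁅x⁆∪p∣≡1+∣p∣ b _ (b≢c ∘ x∈⁅y⁆⇒x≡y c)) (cong suc (∣⁅x⁆∣≡1 c))))
    where
      a∉ : a ∉ ⁅ b ⁆ ∪ ⁅ c ⁆
      a∉ a∈ with x∈p∪q⁻ ⁅ b ⁆ ⁅ c ⁆ a∈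
      ... | inj₁ a∈b = a≢b (x∈⁅y⁆⇒x≡y b a∈b)
      ... | inj₂ a∈c = a≢c (x∈⁅y⁆⇒x≡y c a∈c)

  module _ {Y : Subset n} (a∈ : a ∈ Y) (b∈ : b ∈ Y) (c∈ : c ∈ Y) where

    3≤∣Y∣ : 3 ≤ ∣ Y ∣
    3≤∣Y∣ = subst (_≤ ∣ Y ∣) ∣triple∣≡3 (p⊆q⇒∣p∣≤∣q∣ (triple⊆ a∈ b∈ c∈))

    4≤∣Y∣ : ∀ {d} → d ∈ Y → ¬ OneOf d a b c → 4 ≤ ∣ Y ∣
    4≤∣Y∣ {d} d∈ d∉ = subst (_≤ ∣ Y ∣)
      (trans (x∉p⇒∣⁅x⁆∪p∣≡1+∣p∣ d _ (d∉ ∘ ∈-triple⁻)) (cong suc ∣triple∣≡3))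
      (p⊆q⇒∣p∣≤∣q∣ ⁅d⁆∪triple⊆Y)
      where
        ⁅d⁆∪triple⊆Y : ⁅ d ⁆ ∪ triple a b c ⊆ Y
        ⁅d⁆∪triple⊆Y w∈ with x∈p∪q⁻ ⁅ d ⁆ _ w∈
        ... | inj₁ w∈d rewrite x∈⁅y⁆⇒x≡y d w∈d = d∈
        ... | inj₂ w∈t = triple⊆ a∈ b∈ c∈ w∈t

x∉p-x : ∀ {x : Fin n} {p} → x ∉ p - x
x∉p-x {x = fzero}  {inside  ∷ p} ()
x∉p-x {x = fzero}  {outside ∷ p} ()
x∉p-x {x = fsuc x} {s ∷ p} (there x∈) = x∉p-x x∈

module _ {a b c : Fin n} (a<b : a <ᶠ b) (b<c : b <ᶠ c) where

  least : ∀ {x} → OneOf x a b c → a ≤ᶠ x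
  least (inj₁ refl)        = ≤-refl
  least (inj₂ (inj₁ refl)) = <⇒≤ a<b
  least (inj₂ (inj₂ refl)) = <⇒≤ (<-trans a<b b<c)

  greatest : ∀ {x} → OneOf x a b c → x ≤ᶠ c
  greatest (inj₁ refl)        = <⇒≤ (<-trans a<b b<c)
  greatest (inj₂ (inj₁ refl)) = <⇒≤ b<c
  greatest (inj₂ (inj₂ refl)) = ≤-refl

sorted-triple-injective : ∀ {a b c a′ b′ c′ : Fin n} → a <ᶠ b → b <ᶠ c → a′ <ᶠ b′ → b′ <ᶠ c′
                        → triple a b c ≡ triple a′ b′ c′ → a ≡ a′ × b ≡ b′ × c ≡ c′
sorted-triple-injective {a = a} {b} {c} {a′} {b′} {c′} a<b b<c a′<b′ b′<c′ eq =
  a≡a′ , b≡b′ (moved (inj₂ (inj₁ refl))) , c≡c′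
  where
    moved : ∀ {x} → OneOf x a b c → OneOf x a′ b′ c′
    moved x∈ = ∈-triple⁻ (subst (_ ∈_) eq (∈-triple⁺ x∈))
    moved⁻¹ : ∀ {x} → OneOf x a′ b′ c′ → OneOf x a b c
    moved⁻¹ x∈ = ∈-triple⁻ (subst (_ ∈_) (sym eq) (∈-triple⁺ x∈))
    a≡a′ = Fin.≤-antisym (least a<b b<c (moved⁻¹ (inj₁ refl))) (least a′<b′ b′<c′ (moved (inj₁ refl)))
    c≡c′ = Fin.≤-antisym (greatest a′<b′ b′<c′ (moved (inj₂ (inj₂ refl))))
                         (greatest a<b b<c (moved⁻¹ (inj₂ (inj₂ refl))))
    b≡b′ : OneOf b a′ b′ c′ → b ≡ b′
    b≡b′ (inj₁ refl)        = ⊥-elim (Fin.<-irrefl a≡a′ a<b)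
    b≡b′ (inj₂ (inj₁ e))    = e
    b≡b′ (inj₂ (inj₂ refl)) = ⊥-elim (Fin.<-irrefl (sym c≡c′) b<c)

T-not⇔¬T : ∀ {b} → T (not b) ⇔ (¬ T b)
T-not⇔¬T {true}  = mk⇔ (λ ()) (λ ¬t → ¬t _)
T-not⇔¬T {false} = mk⇔ (λ _ ()) (λ _ → _)

adj-complement : ∀ {n} (Ḡ : Graph n) u v → Adj (complement Ḡ) u v ⇔ (¬ Adj Ḡ u v × u ≢ v)
adj-complement Ḡ u v = mk⇔
  (λ a → let ¬adj , ¬eq = to T-∧ a in
    to T-not⇔¬T ¬adj , λ { refl → to T-not⇔¬T ¬eq (≡⇒≡ᵇ (toℕ u) (toℕ u) refl) })
  (λ (¬adj , u≢v) → from T-∧ (from T-not⇔¬T ¬adj ,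
    from T-not⇔¬T (u≢v ∘ toℕ-injective ∘ ≡ᵇ⇒≡ (toℕ u) (toℕ v))))

-- Independent dominating sets in the complement of a graph

module ComplementOf {n : ℕ} (Ḡ : Graph n) (_∼_ : Fin n → Fin n → Set)
  (∼⇔adj : ∀ u v → u ∼ v ⇔ Adj Ḡ u v) (∼-irrefl : ∀ u → ¬ u ∼ u) (∼-sym : ∀ {u v} → u ∼ v → v ∼ u) where

  G : Graph n
  G = complement Ḡ

  _∼?_ : ∀ u v → Dec (u ∼ v)
  u ∼? v = map′ (from (∼⇔adj u v)) (to (∼⇔adj u v)) (T? (adj Ḡ u v))

  adjG⇔≁ : ∀ u v → Adj G u v ⇔ (¬ u ∼ v × u ≢ v)
  adjG⇔≁ u v = mk⇔
    (λ a → let ¬adj , u≢v = to (adj-complement Ḡ u v) a in ¬adj ∘ to (∼⇔adj u v) , u≢v)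
    (λ (≁ , u≢v) → from (adj-complement Ḡ u v) (≁ ∘ from (∼⇔adj u v) , u≢v))

  ∼⇒≢ : ∀ {u v} → u ∼ v → u ≢ v
  ∼⇒≢ {u} u∼v refl = ∼-irrefl u u∼v

  ≁⇒adjG : ∀ {u v} → ¬ u ∼ v → u ≢ v → Adj G u v
  ≁⇒adjG ≁ u≢v = from (adjG⇔≁ _ _) (≁ , u≢v)

  independent⇒∼ : ∀ {Y u v} → Independent G Y → u ∈ Y → v ∈ Y → u ≢ v → u ∼ v
  independent⇒∼ {u = u} {v} Y-indep u∈ v∈ u≢v with u ∼? v
  ... | yes u∼v = u∼v
  ... | no  u≁v = ⊥-elim (Y-indep u v u∈ v∈ (≁⇒adjG u≁v u≢v))

  dominator : ∀ {Y} → IndepDom G Y → ∀ w → ∃[ u ] (u ∈ Y × ∀ {x} → x ∈ Y → x ∼ w → x ∼ u)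
  dominator (Y-indep , Y-dom) w with Y-dom w
  ... | inj₁ w∈ = w , w∈ , λ _ x∼w → x∼w
  ... | inj₂ (u , u∈ , u-adj-w) = u , u∈ , λ x∈ x∼w →
    independent⇒∼ Y-indep x∈ u∈ λ { refl → proj₁ (to (adjG⇔≁ u w) u-adj-w) x∼w }

  record TriangleIn (Y : Subset n) : Set where
    field
      {x y z} : Fin n
      x∈      : x ∈ Y
      y∈      : y ∈ Y
      z∈      : z ∈ Y
      x∼y     : x ∼ y
      x∼z     : x ∼ z
      y∼z     : y ∼ z

  triangleIn : (∀ a → ∃[ b ] a ∼ b) → (∀ {a b} → a ∼ b → ∃[ c ] (a ∼ c × b ∼ c))
             → Fin n → ∀ {Y} → IndepDom G Y → TriangleIn Y
  triangleIn neighbour commonNeighbour v₀ Y-indepDom = record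
    { x∈ = a∈ ; y∈ = b∈ ; z∈ = c∈ ; x∼y = ∼b a∈ a∼b′ ; x∼z = ∼c a∈ a∼c′ ; y∼z = ∼c b∈ b∼c′ }
    where
      dom = dominator Y-indepDom
      a∈ = proj₁ (proj₂ (dom v₀))
      b′ = proj₁ (neighbour (proj₁ (dom v₀)))
      a∼b′ = proj₂ (neighbour (proj₁ (dom v₀)))
      b∈ = proj₁ (proj₂ (dom b′))
      ∼b = proj₂ (proj₂ (dom b′))
      c′ = proj₁ (commonNeighbour (∼b a∈ a∼b′))
      a∼c′ = proj₁ (proj₂ (commonNeighbour (∼b a∈ a∼b′)))
      b∼c′ = proj₂ (proj₂ (commonNeighbour (∼b a∈ a∼b′)))
      c∈ = proj₁ (proj₂ (dom c′))
      ∼c = proj₂ (proj₂ (dom c′))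

  3≤∣indepDom∣ : ∀ {Y} → TriangleIn Y → 3 ≤ ∣ Y ∣
  3≤∣indepDom∣ t = 3≤∣Y∣ (∼⇒≢ x∼y) (∼⇒≢ x∼z) (∼⇒≢ y∼z) x∈ y∈ z∈
    where open TriangleIn t

  NoCommonNeighbour : Fin n → Fin n → Fin n → Set
  NoCommonNeighbour a b c = ∀ w → a ∼ w → b ∼ w → c ∼ w → ⊥

  triple-indepDom : ∀ {a b c} → a ∼ b → a ∼ c → b ∼ c → NoCommonNeighbour a b c → IndepDom G (triple a b c)
  triple-indepDom {a} {b} {c} a∼b a∼c b∼c maximal = independent , dominating
    where
      equal-or-∼ : ∀ {u v} → OneOf u a b c → OneOf v a b c → u ≡ v ⊎ u ∼ v
      equal-or-∼ (inj₁ refl)        (inj₁ refl)        = inj₁ refl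
      equal-or-∼ (inj₁ refl)        (inj₂ (inj₁ refl)) = inj₂ a∼b
      equal-or-∼ (inj₁ refl)        (inj₂ (inj₂ refl)) = inj₂ a∼c
      equal-or-∼ (inj₂ (inj₁ refl)) (inj₁ refl)        = inj₂ (∼-sym a∼b)
      equal-or-∼ (inj₂ (inj₁ refl)) (inj₂ (inj₁ refl)) = inj₁ refl
      equal-or-∼ (inj₂ (inj₁ refl)) (inj₂ (inj₂ refl)) = inj₂ b∼c
      equal-or-∼ (inj₂ (inj₂ refl)) (inj₁ refl)        = inj₂ (∼-sym a∼c)
      equal-or-∼ (inj₂ (inj₂ refl)) (inj₂ (inj₁ refl)) = inj₂ (∼-sym b∼c)
      equal-or-∼ (inj₂ (inj₂ refl)) (inj₂ (inj₂ refl)) = inj₁ refl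
      independent : Independent G (triple a b c)
      independent u v u∈ v∈ u-adj-v with to (adjG⇔≁ u v) u-adj-v | equal-or-∼ (∈-triple⁻ u∈) (∈-triple⁻ v∈)
      ... | _   , u≢v | inj₁ u≡v = u≢v u≡v
      ... | u≁v , _   | inj₂ u∼v = u≁v u∼v
      dominating : Dominating G (triple a b c)
      dominating w with oneOf? w a b c
      ... | yes w∈ = inj₁ (∈-triple⁺ w∈)
      ... | no  w∉ with a ∼? w | b ∼? w | c ∼? w
      ...   | no a≁w  | _       | _       = inj₂ (a , ∈-triple⁺ a-in , ≁⇒adjG a≁w λ { refl → w∉ a-in })
        where a-in = inj₁ refl
      ...   | yes _   | no b≁w  | _       = inj₂ (b , ∈-triple⁺ b-in , ≁⇒adjG b≁w λ { refl → w∉ b-in })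
        where b-in = inj₂ (inj₁ refl)
      ...   | yes _   | yes _   | no c≁w  = inj₂ (c , ∈-triple⁺ c-in , ≁⇒adjG c≁w λ { refl → w∉ c-in })
        where c-in = inj₂ (inj₂ refl)
      ...   | yes a∼w | yes b∼w | yes c∼w = ⊥-elim (maximal w a∼w b∼w c∼w)

  indepDom⊇triple⇒≡ : ∀ {Y a b c} → IndepDom G Y → a ∈ Y → b ∈ Y → c ∈ Y → NoCommonNeighbour a b c
                    → triple a b c ≡ Y
  indepDom⊇triple⇒≡ {Y} {a} {b} {c} (Y-indep , _) a∈ b∈ c∈ maximal = ⊆-antisym (triple⊆ a∈ b∈ c∈) Y⊆
    where
      Y⊆ : Y ⊆ triple a b c
      Y⊆ {w} w∈ with oneOf? w a b c
      ... | yes w∈t = ∈-triple⁺ w∈t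
      ... | no  w∉t = ⊥-elim (maximal w (∼w a∈ (w∉t ∘ inj₁ ∘ sym)) (∼w b∈ (w∉t ∘ inj₂ ∘ inj₁ ∘ sym))
                                       (∼w c∈ (w∉t ∘ inj₂ ∘ inj₂ ∘ sym)))
        where
          ∼w : ∀ {x} → x ∈ Y → x ≢ w → x ∼ w
          ∼w x∈ x≢w = independent⇒∼ Y-indep x∈ w∈ x≢w

  -- the fourth vertex of a K₄ is forced into Y by domination
  K₄⇒4≤∣indepDom∣ : ∀ {Y a b c d} → IndepDom G Y → a ∈ Y → b ∈ Y → c ∈ Y
    → a ∼ b → a ∼ c → b ∼ c → a ∼ d → b ∼ d → c ∼ d
    → (∀ w → a ∼ w → b ∼ w → c ∼ w → w ≡ d) → 4 ≤ ∣ Y ∣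
  K₄⇒4≤∣indepDom∣ Y-indepDom a∈ b∈ c∈ a∼b a∼c b∼c a∼d b∼d c∼d unique =
    4≤∣Y∣ (∼⇒≢ a∼b) (∼⇒≢ a∼c) (∼⇒≢ b∼c) a∈ b∈ c∈ d∈ d∉
    where
      u∈ = proj₁ (proj₂ (dominator Y-indepDom _))
      ∼u = proj₂ (proj₂ (dominator Y-indepDom _))
      d∈ = subst (_∈ _) (unique _ (∼u a∈ a∼d) (∼u b∈ b∼d) (∼u c∈ c∼d)) u∈
      d∉ : ¬ OneOf _ _ _ _
      d∉ (inj₁ refl)        = ∼-irrefl _ a∼d
      d∉ (inj₂ (inj₁ refl)) = ∼-irrefl _ b∼d
      d∉ (inj₂ (inj₂ refl)) = ∼-irrefl _ c∼d

  swap-triple : ∀ {u v b c} → u ≢ b → u ≢ c → v ≢ b → v ≢ c → u ≢ v → ¬ u ∼ v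
              → ISwap G (triple u b c) (triple v b c)
  swap-triple {u} {v} {b} {c} u≢b u≢c v≢b v≢c u≢v u≁v =
    u , v , ∈-triple⁺ (inj₁ refl) , v∉ , ≁⇒adjG u≁v u≢v , ⊆-antisym ⊆swapped swapped⊆
    where
      v∉ : v ∉ triple u b c
      v∉ v∈ with ∈-triple⁻ v∈
      ... | inj₁ e        = u≢v (sym e)
      ... | inj₂ (inj₁ e) = v≢b e
      ... | inj₂ (inj₂ e) = v≢c e
      ⊆swapped : triple v b c ⊆ (triple u b c - u) ∪ ⁅ v ⁆
      ⊆swapped {w} w∈ with ∈-triple⁻ w∈
      ... | inj₁ refl        = x∈p∪q⁺ (inj₂ (x∈⁅x⁆ w))
      ... | inj₂ (inj₁ refl) = x∈p∪q⁺ (inj₁ (x∈p∧x≢y⇒x∈p-y (∈-triple⁺ (inj₂ (inj₁ refl))) (u≢b ∘ sym)))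
      ... | inj₂ (inj₂ refl) = x∈p∪q⁺ (inj₁ (x∈p∧x≢y⇒x∈p-y (∈-triple⁺ (inj₂ (inj₂ refl))) (u≢c ∘ sym)))
      swapped⊆ : (triple u b c - u) ∪ ⁅ v ⁆ ⊆ triple v b c
      swapped⊆ {w} w∈ with x∈p∪q⁻ (triple u b c - u) ⁅ v ⁆ w∈
      ... | inj₂ w∈v rewrite x∈⁅y⁆⇒x≡y v w∈v = ∈-triple⁺ (inj₁ refl)
      ... | inj₁ w∈t-u with ∈-triple⁻ (p─q⊆p _ _ w∈t-u)
      ...   | inj₁ refl = ⊥-elim (x∉p-x w∈t-u)
      ...   | inj₂ w∈bc = ∈-triple⁺ (inj₂ w∈bc)

  record SwapOf (X Y : Subset n) : Set where
    field
      {removed added} : Fin n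
      removed∈ : removed ∈ X
      added∉ : added ∉ X
      kept : ∀ {w} → w ∈ X → w ≢ removed → w ∈ Y
      added∈ : added ∈ Y

  swapOf : ∀ {X Y} → ISwap G X Y → SwapOf X Y
  swapOf {X} (u , v , u∈ , v∉ , u-adj-v , refl) = record
    { removed∈ = u∈ ; added∉ = v∉
    ; kept = λ w∈ w≢u → x∈p∪q⁺ (inj₁ (x∈p∧x≢y⇒x∈p-y w∈ w≢u)) ; added∈ = x∈p∪q⁺ (inj₂ (x∈⁅x⁆ v)) }

IGraphIso-intro : ∀ {n} {G : Graph n} {H : AbsGraph} (φ : V H → Subset n) (x₀ : V H) (m : ℕ)
  → (∀ x → IndepDom G (φ x)) → (∀ x → ∣ φ x ∣ ≤ m) → (∀ Y → IndepDom G Y → m ≤ ∣ Y ∣)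
  → (∀ X → IndepDom G X → ∣ X ∣ ≤ m → ∃[ x ] φ x ≡ X)
  → (∀ x y → φ x ≡ φ y → x ≡ y)
  → (∀ x y → E H x y ⇔ ISwap G (φ x) (φ y))
  → IGraphIso G H
IGraphIso-intro φ x₀ m φ-indepDom ∣φ∣≤m m≤indepDom onto injective edges =
  φ , (λ x → φ-indepDom x , λ Y Y-indepDom → ≤-trans (∣φ∣≤m x) (m≤indepDom Y Y-indepDom))
    , injective
    , (λ X X-iset → onto X (proj₁ X-iset) (≤-trans (proj₂ X-iset (φ x₀) (φ-indepDom x₀)) (∣φ∣≤m x₀)))
    , edges

-- The theta graph θ₂,₂,ₘ₊₂

module Theta₂₂ (m : ℕ) where

  Θ : AbsGraph
  Θ = θ 2 2 (suc (suc m))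

  Vertex : Set
  Vertex = ThetaV 2 2 (suc (suc m))

  pattern mid₀   = inner fzero fzero
  pattern mid₁   = inner (fsuc fzero) fzero
  pattern long s = inner (fsuc (fsuc fzero)) s

  data Step : Vertex → Vertex → Set where
    a→mid₀    : Step endA mid₀
    mid₀→b    : Step mid₀ endB
    a→mid₁    : Step endA mid₁
    mid₁→b    : Step mid₁ endB
    a→long    : Step endA (long fzero)
    long→long : ∀ s t → toℕ t ≡ suc (toℕ s) → Step (long s) (long t)
    long→b    : ∀ s → toℕ s ≡ m → Step (long s) endB

  private
    fin1 : (s : Fin 1) → s ≡ fzero
    fin1 fzero = refl

    toℕ≡0 : ∀ {p} (s : Fin (suc p)) → toℕ s ≡ 0 → s ≡ fzero
    toℕ≡0 fzero _ = refl

    step : ∀ {i s t x y} → OnPath {2} {2} {suc (suc m)} i x s → OnPath i y t → suc s ≡ t → Step x y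
    step {fzero}                atA          (atInner t)  _ rewrite fin1 t = a→mid₀
    step {fsuc fzero}           atA          (atInner t)  _ rewrite fin1 t = a→mid₁
    step {fsuc (fsuc fzero)}    atA          (atInner t)  e rewrite toℕ≡0 t (sym (suc-injective e)) = a→long
    step {fzero}                (atInner s)  atB          _ rewrite fin1 s = mid₀→b
    step {fsuc fzero}           (atInner s)  atB          _ rewrite fin1 s = mid₁→b
    step {fsuc (fsuc fzero)}    (atInner s)  atB          e = long→b s (suc-injective (suc-injective e))
    step {fsuc (fsuc fzero)}    (atInner s)  (atInner t)  e = long→long s t (sym (suc-injective e))
    step {fzero}                (atInner s)  (atInner t)  e rewrite fin1 s | fin1 t with () ← e
    step {fsuc fzero}           (atInner s)  (atInner t)  e rewrite fin1 s | fin1 t with () ← e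
    step {fzero}                atA          atB          ()
    step {fsuc fzero}           atA          atB          ()
    step {fsuc (fsuc fzero)}    atA          atB          ()
    step                        atA          atA          ()
    step                        (atInner s)  atA          ()
    step                        atB          atA          ()
    step                        atB          atB          e = ⊥-elim (<-irrefl (sym e) (n<1+n _))
    step                        atB          (atInner t)  e =
      ⊥-elim (<-irrefl (sym (suc-injective e)) (≤-trans (toℕ<n t) pred[n]≤n))

    unstep : ∀ {x y} → Step x y → E Θ x y
    unstep a→mid₀              = fzero , 0 , 1 , atA , atInner fzero , inj₁ refl
    unstep mid₀→b              = fzero , 1 , 2 , atInner fzero , atB , inj₁ refl
    unstep a→mid₁              = fsuc fzero , 0 , 1 , atA , atInner fzero , inj₁ refl
    unstep mid₁→b              = fsuc fzero , 1 , 2 , atInner fzero , atB , inj₁ refl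
    unstep a→long              = fsuc (fsuc fzero) , 0 , 1 , atA , atInner fzero , inj₁ refl
    unstep (long→long s t e)   = fsuc (fsuc fzero) , _ , _ , atInner s , atInner t , inj₁ (cong suc (sym e))
    unstep (long→b s e)        = fsuc (fsuc fzero) , _ , _ , atInner s , atB , inj₁ (cong (suc ∘ suc) e)

  edge⇔step : ∀ x y → E Θ x y ⇔ (Step x y ⊎ Step y x)
  edge⇔step x y = mk⇔
    (λ { (i , s , t , x-at , y-at , inj₁ e) → inj₁ (step x-at y-at e)
       ; (i , s , t , x-at , y-at , inj₂ e) → inj₂ (step y-at x-at e) })
    (λ { (inj₁ x→y) → unstep x→y ; (inj₂ y→x) → flip (unstep y→x) })
    where
      flip : ∀ {y x} → E Θ y x → E Θ x y
      flip (i , s , t , y-at , x-at , e) = i , t , s , x-at , y-at , swap e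

  step? : ∀ x y → Dec (Step x y)
  step? endA     endA              = no λ ()
  step? endA     endB              = no λ ()
  step? endA     mid₀              = yes a→mid₀
  step? endA     mid₁              = yes a→mid₁
  step? endA     (long fzero)      = yes a→long
  step? endA     (long (fsuc _))   = no λ ()
  step? endB     _                 = no λ ()
  step? mid₀     endA              = no λ ()
  step? mid₀     endB              = yes mid₀→b
  step? mid₀     (inner _ _)       = no λ ()
  step? mid₁     endA              = no λ ()
  step? mid₁     endB              = yes mid₁→b
  step? mid₁     (inner _ _)       = no λ ()
  step? (long s) endA              = no λ ()
  step? (long s) endB              = map′ (long→b s) (λ { (long→b _ e) → e }) (toℕ s ≟ m)
  step? (long s) mid₀              = no λ ()
  step? (long s) mid₁              = no λ ()
  step? (long s) (long t)          = map′ (long→long s t) (λ { (long→long _ _ e) → e }) (toℕ t ≟ suc (toℕ s))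

  edge? : ∀ x y → Dec (E Θ x y)
  edge? x y = map′ (from (edge⇔step x y)) (to (edge⇔step x y)) (step? x y ⊎-dec step? y x)

  _≟ᵥ_ : (x y : Vertex) → Dec (x ≡ y)
  endA      ≟ᵥ endA      = yes refl
  endA      ≟ᵥ endB      = no λ ()
  endA      ≟ᵥ inner _ _ = no λ ()
  endB      ≟ᵥ endA      = no λ ()
  endB      ≟ᵥ endB      = yes refl
  endB      ≟ᵥ inner _ _ = no λ ()
  inner _ _ ≟ᵥ endA      = no λ ()
  inner _ _ ≟ᵥ endB      = no λ ()
  inner i s ≟ᵥ inner j t with i ≟ᶠ j
  ... | no  i≢j  = no λ { refl → i≢j refl }
  ... | yes refl = map′ (cong (inner i)) (λ { refl → refl }) (s ≟ᶠ t)

  all-vertices? : {P : Vertex → Set} → (∀ x → Dec (P x)) → Dec (∀ x → P x)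
  all-vertices? P? = map′
    (λ { (pA , pB , p₀ , p₁ , pₗ) → λ { endA → pA ; endB → pB ; mid₀ → p₀
                                      ; mid₁ → p₁ ; (long t) → pₗ t } })
    (λ p → p endA , p endB , p mid₀ , p mid₁ , λ t → p (long t))
    (P? endA ×-dec P? endB ×-dec P? mid₀ ×-dec P? mid₁ ×-dec Fin.all? (λ t → P? (long t)))

  any-vertex? : {P : Vertex → Set} → (∀ x → Dec (P x)) → Dec (∃ P)
  any-vertex? P? = map′
    (λ { (inj₁ pA) → endA , pA ; (inj₂ (inj₁ pB)) → endB , pB ; (inj₂ (inj₂ (inj₁ p₀))) → mid₀ , p₀
       ; (inj₂ (inj₂ (inj₂ (inj₁ p₁)))) → mid₁ , p₁ ; (inj₂ (inj₂ (inj₂ (inj₂ (t , pₗ))))) → long t , pₗ })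
    (λ { (endA , p) → inj₁ p ; (endB , p) → inj₂ (inj₁ p) ; (mid₀ , p) → inj₂ (inj₂ (inj₁ p))
       ; (mid₁ , p) → inj₂ (inj₂ (inj₂ (inj₁ p))) ; (long t , p) → inj₂ (inj₂ (inj₂ (inj₂ (t , p)))) })
    (P? endA ⊎-dec P? endB ⊎-dec P? mid₀ ⊎-dec P? mid₁ ⊎-dec Fin.any? (λ t → P? (long t)))

-- The case ℓ = 5

_⇔?_ : ∀ {A B : Set} → Dec A → Dec B → Dec (A ⇔ B)
a? ⇔? b? = map′ (λ (f , g) → mk⇔ f g) (λ e → to e , from e) ((a? →-dec b?) ×-dec (b? →-dec a?))

module Decide {n : ℕ} (G : Graph n) where

  adj? : ∀ u v → Dec (Adj G u v)
  adj? u v = T? (adj G u v)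

  indepDom? : ∀ X → Dec (IndepDom G X)
  indepDom? X = (Fin.all? λ u → Fin.all? λ v → (u ∈? X) →-dec (v ∈? X) →-dec ¬? (adj? u v))
           ×-dec (Fin.all? λ v → (v ∈? X) ⊎-dec Fin.any? λ u → (u ∈? X) ×-dec adj? u v)

  iswap? : ∀ X Y → Dec (ISwap G X Y)
  iswap? X Y = Fin.any? λ u → Fin.any? λ v →
    (u ∈? X) ×-dec ¬? (v ∈? X) ×-dec adj? u v ×-dec ≡-dec _≟ᵇ_ Y ((X - u) ∪ ⁅ v ⁆)

module CaseB where
  open Theta₂₂ 3
  open Decide (complement Gbar-b)

  φ : Vertex → Subset 9
  φ endA                              = triple (# 0) (# 1) (# 2)
  φ mid₀                              = triple (# 0) (# 1) (# 4)
  φ mid₁                              = triple (# 0) (# 2) (# 3)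
  φ endB                              = triple (# 0) (# 3) (# 4)
  φ (long fzero)                      = triple (# 1) (# 2) (# 5)
  φ (long (fsuc fzero))               = triple (# 2) (# 5) (# 6)
  φ (long (fsuc (fsuc fzero)))        = triple (# 4) (# 5) (# 6)
  φ (long (fsuc (fsuc (fsuc fzero)))) = triple (# 3) (# 4) (# 6)

  iso : IGraphIso (complement Gbar-b) (θ 2 2 5)
  iso = IGraphIso-intro φ endA 3
    (toWitness {a? = all-vertices? λ x → indepDom? (φ x)} _)
    (toWitness {a? = all-vertices? λ x → ∣ φ x ∣ ≤? 3} _)
    (λ Y Y-indepDom → decidable-stable (3 ≤? ∣ Y ∣) λ ∣Y∣<3 →
      toWitnessFalse {a? = anySubset? λ Y → indepDom? Y ×-dec ¬? (3 ≤? ∣ Y ∣)} _ (Y , Y-indepDom , ∣Y∣<3))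
    (λ X X-indepDom ∣X∣≤3 → decidable-stable (any-vertex? λ x → φ x ≟ˢ X) λ ∄x →
      toWitnessFalse {a? = anySubset? λ X → indepDom? X ×-dec (∣ X ∣ ≤? 3) ×-dec ¬? (any-vertex? λ x → φ x ≟ˢ X)} _
        (X , X-indepDom , ∣X∣≤3 , ∄x))
    (toWitness {a? = all-vertices? λ x → all-vertices? λ y → (φ x ≟ˢ φ y) →-dec (x ≟ᵥ y)} _)
    (toWitness {a? = all-vertices? λ x → all-vertices? λ y → edge? x y ⇔? iswap? (φ x) (φ y)} _)
    where
      _≟ˢ_ : (X Y : Subset 9) → Dec (X ≡ Y)
      _≟ˢ_ = ≡-dec _≟ᵇ_

-- The case ℓ ≥ 6: the graph Ḡ

Joins : ℕ → ℕ → ℕ × ℕ → Set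
Joins a b (x , y) = (a ≡ x × b ≡ y) ⊎ (a ≡ y × b ≡ x)

module _ {n : ℕ} (u v : Fin n) where
  private
    a = toℕ u
    b = toℕ v

    ≡ᵇ⇔≡ : ∀ m n → T (m ≡ᵇ n) ⇔ (m ≡ n)
    ≡ᵇ⇔≡ m n = mk⇔ (≡ᵇ⇒≡ m n) (≡⇒≡ᵇ m n)

    joins⇔ : ∀ x y → T (((a ≡ᵇ x) ∧ (b ≡ᵇ y)) ∨ ((a ≡ᵇ y) ∧ (b ≡ᵇ x))) ⇔ Joins a b (x , y)
    joins⇔ x y = mk⇔
      (Sum.map (Product.map (to (≡ᵇ⇔≡ a x)) (to (≡ᵇ⇔≡ b y)) ∘ to T-∧)
               (Product.map (to (≡ᵇ⇔≡ a y)) (to (≡ᵇ⇔≡ b x)) ∘ to T-∧) ∘ to T-∨)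
      (from T-∨ ∘ Sum.map (from T-∧ ∘ Product.map (from (≡ᵇ⇔≡ a x)) (from (≡ᵇ⇔≡ b y)))
                          (from T-∧ ∘ Product.map (from (≡ᵇ⇔≡ a y)) (from (≡ᵇ⇔≡ b x))))

  adj-fromEdges⁻ : ∀ es → Adj (fromEdges n es) u v → Any (Joins a b) es
  adj-fromEdges⁻ ((x , y) ∷ es) t with to T-∨ t
  ... | inj₁ t-here  = here (to (joins⇔ x y) t-here)
  ... | inj₂ t-there = there (adj-fromEdges⁻ es t-there)

  adj-fromEdges⁺ : ∀ es → Any (Joins a b) es → Adj (fromEdges n es) u v
  adj-fromEdges⁺ ((x , y) ∷ es) (here j)  = from T-∨ (inj₁ (from (joins⇔ x y) j))
  adj-fromEdges⁺ ((x , y) ∷ es) (there j) = from (T-∨ {((a ≡ᵇ x) ∧ (b ≡ᵇ y)) ∨ ((a ≡ᵇ y) ∧ (b ≡ᵇ x))})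
                                               (inj₂ (adj-fromEdges⁺ es j))

-- Labels: w₀,…,w₄ = 0,…,4; vᵢ = 4 + i (1 ≤ i ≤ k + 3, where ℓ = 6 + k); z = 8 + k.
-- Each edge of Ḡ is listed once, smaller label first.
data Edge (k : ℕ) : ℕ → ℕ → Set where
  w₀w₁ : Edge k 0 1
  w₀w₂ : Edge k 0 2
  w₀w₃ : Edge k 0 3
  w₀w₄ : Edge k 0 4
  w₁w₂ : Edge k 1 2
  w₁w₄ : Edge k 1 4
  w₂w₃ : Edge k 2 3
  w₃w₄ : Edge k 3 4
  vv   : ∀ j → j < 2 + k → Edge k (5 + j) (6 + j)
  w₁v  : ∀ j → j < 2 + k → Edge k 1 (5 + j)
  vv′  : Edge k (5 + k) (7 + k)
  w₂v  : Edge k 2 5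
  w₃v  : Edge k 3 (7 + k)
  w₄v′ : Edge k 4 (6 + k)
  w₄v  : Edge k 4 (7 + k)
  w₁z  : Edge k 1 (8 + k)
  w₄z  : Edge k 4 (8 + k)
  vz   : Edge k (6 + k) (8 + k)

Adjacent : ℕ → ℕ → ℕ → Set
Adjacent k a b = Edge k a b ⊎ Edge k b a

-- The edge list of Gbar-a k, cut into its segments; edges is definitionally that list.
module EdgeList (k : ℕ) where

  pathEdges w₁Edges otherEdges edges : List (ℕ × ℕ)
  pathEdges  = List.map (λ j → (5 + j , 6 + j)) (upTo (k + 2))
  w₁Edges    = List.map (λ j → (1 , 5 + j)) (upTo (k + 2))
  otherEdges = (k + 5 , k + 7) ∷ (2 , 5) ∷ (3 , k + 7) ∷ (4 , k + 6) ∷ (4 , k + 7)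
             ∷ (k + 8 , 1) ∷ (k + 8 , 4) ∷ (k + 8 , k + 6) ∷ []
  edges      = wheelEdges ++ pathEdges ++ w₁Edges ++ otherEdges

  module _ {a b : ℕ} where

    private
      listed : ∀ {x y x′ y′} → Edge k x y → x′ ≡ x → y′ ≡ y → Joins a b (x′ , y′) → Adjacent k a b
      listed e refl refl (inj₁ (refl , refl)) = inj₁ e
      listed e refl refl (inj₂ (refl , refl)) = inj₂ e

      comm : ∀ m → k + m ≡ m + k
      comm m = +-comm k m

    joins⇒adjacent : Any (Joins a b) edges → Adjacent k a b
    joins⇒adjacent j with ++⁻ wheelEdges j
    ... | inj₁ (here j)                                                 = listed w₁w₂ refl refl j
    ... | inj₁ (there (here j))                                         = listed w₂w₃ refl refl j
    ... | inj₁ (there (there (here j)))                                 = listed w₃w₄ refl refl j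
    ... | inj₁ (there (there (there (here j))))                         = listed w₁w₄ refl refl (swap j)
    ... | inj₁ (there (there (there (there (here j)))))                 = listed w₀w₁ refl refl j
    ... | inj₁ (there (there (there (there (there (here j))))))         = listed w₀w₂ refl refl j
    ... | inj₁ (there (there (there (there (there (there (here j))))))) = listed w₀w₃ refl refl j
    ... | inj₁ (there (there (there (there (there (there (there (here j)))))))) = listed w₀w₄ refl refl j
    ... | inj₂ j with ++⁻ pathEdges j
    ...   | inj₁ p with applyUpTo⁻ id (map⁻ p)
    ...     | i , i< , j = listed (vv i (subst₂ _<_ refl (comm 2) i<)) refl refl j
    joins⇒adjacent _ | inj₂ _ | inj₂ j with ++⁻ w₁Edges j
    ...   | inj₁ p with applyUpTo⁻ id (map⁻ p)
    ...     | i , i< , j = listed (w₁v i (subst₂ _<_ refl (comm 2) i<)) refl refl j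
    joins⇒adjacent _ | inj₂ _ | inj₂ _ | inj₂ (here j)                 = listed vv′ (comm 5) (comm 7) j
    joins⇒adjacent _ | inj₂ _ | inj₂ _ | inj₂ (there (here j))         = listed w₂v refl refl j
    joins⇒adjacent _ | inj₂ _ | inj₂ _ | inj₂ (there (there (here j))) = listed w₃v refl (comm 7) j
    joins⇒adjacent _ | inj₂ _ | inj₂ _ | inj₂ (there (there (there (here j)))) = listed w₄v′ refl (comm 6) j
    joins⇒adjacent _ | inj₂ _ | inj₂ _ | inj₂ (there (there (there (there (here j))))) = listed w₄v refl (comm 7) j
    joins⇒adjacent _ | inj₂ _ | inj₂ _ | inj₂ (there (there (there (there (there (here j)))))) =
      listed w₁z refl (comm 8) (swap j)
    joins⇒adjacent _ | inj₂ _ | inj₂ _ | inj₂ (there (there (there (there (there (there (here j))))))) =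
      listed w₄z refl (comm 8) (swap j)
    joins⇒adjacent _ | inj₂ _ | inj₂ _ | inj₂ (there (there (there (there (there (there (there (here j)))))))) =
      listed vz (comm 6) (comm 8) (swap j)

    private
      relabel : ∀ {x y x′ y′} → x′ ≡ x → y′ ≡ y → Joins a b (x , y) → Joins a b (x′ , y′)
      relabel refl refl j = j

      inWheel : Any (Joins a b) wheelEdges → Any (Joins a b) edges
      inWheel = ++⁺ˡ
      inPath : Any (Joins a b) pathEdges → Any (Joins a b) edges
      inPath = ++⁺ʳ wheelEdges ∘ ++⁺ˡ
      inW₁ : Any (Joins a b) w₁Edges → Any (Joins a b) edges
      inW₁ = ++⁺ʳ wheelEdges ∘ ++⁺ʳ pathEdges ∘ ++⁺ˡ
      inOther : Any (Joins a b) otherEdges → Any (Joins a b) edges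
      inOther = ++⁺ʳ wheelEdges ∘ ++⁺ʳ pathEdges ∘ ++⁺ʳ w₁Edges

      listedAt : ∀ {x y} → Edge k x y → Joins a b (x , y) → Any (Joins a b) edges
      listedAt w₀w₁ j = inWheel (there (there (there (there (here j)))))
      listedAt w₀w₂ j = inWheel (there (there (there (there (there (here j))))))
      listedAt w₀w₃ j = inWheel (there (there (there (there (there (there (here j)))))))
      listedAt w₀w₄ j = inWheel (there (there (there (there (there (there (there (here j))))))))
      listedAt w₁w₂ j = inWheel (here j)
      listedAt w₂w₃ j = inWheel (there (here j))
      listedAt w₃w₄ j = inWheel (there (there (here j)))
      listedAt w₁w₄ j = inWheel (there (there (there (here (swap j)))))
      listedAt (vv i i<)  j = inPath (map⁺ (applyUpTo⁺ id j (subst₂ _<_ refl (sym (comm 2)) i<)))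
      listedAt (w₁v i i<) j = inW₁ (map⁺ (applyUpTo⁺ id j (subst₂ _<_ refl (sym (comm 2)) i<)))
      listedAt vv′  j = inOther (here (relabel (comm 5) (comm 7) j))
      listedAt w₂v  j = inOther (there (here j))
      listedAt w₃v  j = inOther (there (there (here (relabel refl (comm 7) j))))
      listedAt w₄v′ j = inOther (there (there (there (here (relabel refl (comm 6) j)))))
      listedAt w₄v  j = inOther (there (there (there (there (here (relabel refl (comm 7) j))))))
      listedAt w₁z  j = inOther (there (there (there (there (there (here (swap (relabel refl (comm 8) j))))))))
      listedAt w₄z  j = inOther (there (there (there (there (there (there (here (swap (relabel refl (comm 8) j)))))))))
      listedAt vz   j = inOther (there (there (there (there (there (there (there (here (swap (relabel (comm 6) (comm 8) j))))))))))

    adjacent⇒joins : Adjacent k a b → Any (Joins a b) edges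
    adjacent⇒joins (inj₁ e) = listedAt e (inj₁ (refl , refl))
    adjacent⇒joins (inj₂ e) = listedAt e (inj₂ (refl , refl))

adjacent⇔adj : ∀ k (u v : Fin (k + 9)) → Adjacent k (toℕ u) (toℕ v) ⇔ Adj (Gbar-a k) u v
adjacent⇔adj k u v = mk⇔ (adj-fromEdges⁺ u v edges ∘ adjacent⇒joins) (joins⇒adjacent ∘ adj-fromEdges⁻ u v edges)
  where open EdgeList k

private variable
  k a b c d p q v w : ℕ

Edge⇒< : Edge k a b → a < b
Edge⇒< w₀w₁      = s≤s z≤n
Edge⇒< w₀w₂      = s≤s z≤n
Edge⇒< w₀w₃      = s≤s z≤n
Edge⇒< w₀w₄      = s≤s z≤n
Edge⇒< w₁w₂      = s≤s (s≤s z≤n)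
Edge⇒< w₁w₄      = s≤s (s≤s z≤n)
Edge⇒< w₂w₃      = s≤s (s≤s (s≤s z≤n))
Edge⇒< w₃w₄      = s≤s (s≤s (s≤s (s≤s z≤n)))
Edge⇒< (vv _ _)  = ≤-refl
Edge⇒< (w₁v _ _) = s≤s (s≤s z≤n)
Edge⇒< vv′       = s≤s (s≤s (s≤s (s≤s (s≤s (s≤s (n≤1+n _))))))
Edge⇒< w₂v       = s≤s (s≤s (s≤s z≤n))
Edge⇒< w₃v       = s≤s (s≤s (s≤s (s≤s z≤n)))
Edge⇒< w₄v′      = s≤s (s≤s (s≤s (s≤s (s≤s z≤n))))
Edge⇒< w₄v       = s≤s (s≤s (s≤s (s≤s (s≤s z≤n))))
Edge⇒< w₁z       = s≤s (s≤s z≤n)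
Edge⇒< w₄z       = s≤s (s≤s (s≤s (s≤s (s≤s z≤n))))
Edge⇒< vz        = s≤s (s≤s (s≤s (s≤s (s≤s (s≤s (s≤s (n≤1+n _)))))))

no-cycle : Edge k a b → Edge k b c → Edge k c a → ⊥
no-cycle ab bc ca = <-asym (Edge⇒< ab) (<-trans (Edge⇒< bc) (Edge⇒< ca))

Adjacent-irrefl : Adjacent k a a → ⊥
Adjacent-irrefl (inj₁ e) = <-irrefl refl (Edge⇒< e)
Adjacent-irrefl (inj₂ e) = <-irrefl refl (Edge⇒< e)

Adjacent-sym : Adjacent k a b → Adjacent k b a
Adjacent-sym = swap

-- The case ℓ ≥ 6: triangles of Ḡ

record Sorted (k a b c : ℕ) : Set where
  constructor sorted
  field
    ab : Edge k a b
    ac : Edge k a c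
    bc : Edge k b c

-- The triangles of Ḡ not contained in a K₄, by their sorted labels.
data MaxTriangle (k : ℕ) : ℕ → ℕ → ℕ → Set where
  w₀w₁w₂ : MaxTriangle k 0 1 2
  w₀w₁w₄ : MaxTriangle k 0 1 4
  w₀w₂w₃ : MaxTriangle k 0 2 3
  w₀w₃w₄ : MaxTriangle k 0 3 4
  w₁w₂v  : MaxTriangle k 1 2 5
  w₁vv   : ∀ j → j ≤ k → MaxTriangle k 1 (5 + j) (6 + j)
  vvv    : MaxTriangle k (5 + k) (6 + k) (7 + k)
  w₄vv   : MaxTriangle k 4 (6 + k) (7 + k)
  w₃w₄v  : MaxTriangle k 3 4 (7 + k)

-- The triangles of the unique K₄ of Ḡ, on w₁, w₄, v_{ℓ-4}, z.
data K₄Triangle (k : ℕ) : ℕ → ℕ → ℕ → Set where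
  w₁w₄v : K₄Triangle k 1 4 (6 + k)
  w₁w₄z : K₄Triangle k 1 4 (8 + k)
  w₁vz  : K₄Triangle k 1 (6 + k) (8 + k)
  w₄vz  : K₄Triangle k 4 (6 + k) (8 + k)

maxTriangle-sorted : MaxTriangle k a b c → Sorted k a b c
maxTriangle-sorted w₀w₁w₂     = sorted w₀w₁ w₀w₂ w₁w₂
maxTriangle-sorted w₀w₁w₄     = sorted w₀w₁ w₀w₄ w₁w₄
maxTriangle-sorted w₀w₂w₃     = sorted w₀w₂ w₀w₃ w₂w₃
maxTriangle-sorted w₀w₃w₄     = sorted w₀w₃ w₀w₄ w₃w₄
maxTriangle-sorted w₁w₂v      = sorted w₁w₂ (w₁v 0 (s≤s z≤n)) w₂v
maxTriangle-sorted (w₁vv j j≤k) =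
  sorted (w₁v j (s≤s (≤-trans j≤k (n≤1+n _)))) (w₁v (suc j) (s≤s (s≤s j≤k))) (vv j (s≤s (≤-trans j≤k (n≤1+n _))))
maxTriangle-sorted vvv        = sorted (vv _ (s≤s (n≤1+n _))) vv′ (vv _ ≤-refl)
maxTriangle-sorted w₄vv       = sorted w₄v′ w₄v (vv _ ≤-refl)
maxTriangle-sorted w₃w₄v      = sorted w₃w₄ w₃v w₄v

k₄Triangle-sorted : K₄Triangle k a b c → Sorted k a b c
k₄Triangle-sorted w₁w₄v = sorted w₁w₄ (w₁v _ ≤-refl) w₄v′
k₄Triangle-sorted w₁w₄z = sorted w₁w₄ w₁z w₄z
k₄Triangle-sorted w₁vz  = sorted (w₁v _ ≤-refl) w₁z vz
k₄Triangle-sorted w₄vz  = sorted w₄v′ w₄z vz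

classify : Edge k a b → Edge k a c → Edge k b c → MaxTriangle k a b c ⊎ K₄Triangle k a b c
classify w₀w₁ () (w₁v _ _)
classify w₀w₁ () w₁z
classify w₀w₃ () w₃v
classify w₀w₁ w₀w₂ w₁w₂ = inj₁ w₀w₁w₂
classify w₀w₁ w₀w₄ w₁w₄ = inj₁ w₀w₁w₄
classify w₀w₂ w₀w₃ w₂w₃ = inj₁ w₀w₂w₃
classify w₀w₃ w₀w₄ w₃w₄ = inj₁ w₀w₃w₄
classify w₁w₂ (w₁v .0 _) w₂v = inj₁ w₁w₂v
classify w₁w₄ (w₁v _ _) w₄v′ = inj₂ w₁w₄v
classify w₁w₄ (w₁v _ p) w₄v = ⊥-elim (n≮n _ p)
classify w₁w₄ (w₁v _ p) w₄z = ⊥-elim (m+n≮n 1 _ p)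
classify w₁w₄ w₁z w₄z = inj₂ w₁w₄z
classify w₃w₄ w₃v w₄v = inj₁ w₃w₄v
classify w₄v′ w₄v (vv _ _) = inj₁ w₄vv
classify w₄v′ w₄z vz = inj₂ w₄vz
classify w₄v w₄z (vv _ p) = ⊥-elim (n≮n _ p)
classify (vv j p) vv′ (vv _ _) = inj₁ vvv
classify (vv j p) vz (vv _ q) = ⊥-elim (n≮n _ q)
classify (w₁v j p) (w₁v _ q) (vv .j _) = inj₁ (w₁vv j (≤-pred (≤-pred q)))
classify (w₁v j p) (w₁v _ q) vv′ = ⊥-elim (n≮n _ q)
classify (w₁v j p) (w₁v _ q) vz = ⊥-elim (m+n≮n 1 _ q)
classify (w₁v j p) w₁z (vv _ q) = ⊥-elim (n≮n _ q)
classify (w₁v j p) w₁z vz = inj₂ w₁vz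
classify w₁z (w₁v _ _) (vv _ q) = ⊥-elim (m+n≮n 1 _ q)

data K₄ (k : ℕ) : ℕ → ℕ → ℕ → ℕ → Set where
  w₁w₄vz : K₄ k 1 4 (6 + k) (8 + k)

maxTriangle-unextendable : MaxTriangle k a b c → Edge k a d → Edge k b d → Edge k c d → ⊥
maxTriangle-unextendable w₀w₁w₂ _ () w₂w₃
maxTriangle-unextendable w₀w₁w₂ () _ w₂v
maxTriangle-unextendable w₀w₁w₄ () _ w₄v′
maxTriangle-unextendable w₀w₁w₄ () _ w₄v
maxTriangle-unextendable w₀w₁w₄ () _ w₄z
maxTriangle-unextendable w₀w₂w₃ _ () w₃w₄
maxTriangle-unextendable w₀w₂w₃ () _ w₃v
maxTriangle-unextendable w₀w₃w₄ () _ w₄v′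
maxTriangle-unextendable w₀w₃w₄ () _ w₄v
maxTriangle-unextendable w₀w₃w₄ () _ w₄z
maxTriangle-unextendable w₁w₂v _ () (vv _ _)
maxTriangle-unextendable w₁w₂v _ () vv′
maxTriangle-unextendable (w₁vv _ _) (w₁v _ q) vv′ (vv _ _) = n≮n _ q
maxTriangle-unextendable (w₁vv _ j≤k) _ vz (vv _ _) = n≮n _ j≤k
maxTriangle-unextendable vvv _ _ (vv _ q) = n≮n _ q
maxTriangle-unextendable w₄vv _ _ (vv _ q) = n≮n _ q
maxTriangle-unextendable w₃w₄v _ _ (vv _ q) = n≮n _ q

k₄Triangle-extension : K₄Triangle k a b c → Edge k a d → Edge k b d → Edge k c d → K₄ k a b c d
k₄Triangle-extension w₁w₄v (w₁v _ q) _ (vv _ _) = ⊥-elim (n≮n _ q)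
k₄Triangle-extension w₁w₄v _ _ vz = w₁w₄vz
k₄Triangle-extension w₁w₄z _ _ (vv _ q) = ⊥-elim (m+n≮n 1 _ q)
k₄Triangle-extension w₁vz  _ _ (vv _ q) = ⊥-elim (m+n≮n 1 _ q)
k₄Triangle-extension w₄vz  _ _ (vv _ q) = ⊥-elim (m+n≮n 1 _ q)

sorted-K₄ : Sorted k a b c → Edge k a d → Edge k b d → Edge k c d → K₄ k a b c d
sorted-K₄ (sorted ab ac bc) ad bd cd with classify ab ac bc
... | inj₁ t = ⊥-elim (maxTriangle-unextendable t ad bd cd)
... | inj₂ t = k₄Triangle-extension t ad bd cd

-- where a common neighbour w falls in the order of a sorted triangle
common-neighbour-K₄ : Sorted k a b c → Adjacent k a w → Adjacent k b w → Adjacent k c w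
                    → K₄ k w a b c ⊎ K₄ k a w b c ⊎ K₄ k a b w c ⊎ K₄ k a b c w
common-neighbour-K₄ abc@(sorted ab ac bc) (inj₁ aw) (inj₁ bw) (inj₁ cw) = inj₂ (inj₂ (inj₂ (sorted-K₄ abc aw bw cw)))
common-neighbour-K₄ (sorted ab ac bc) (inj₁ aw) (inj₁ bw) (inj₂ wc) = inj₂ (inj₂ (inj₁ (sorted-K₄ (sorted ab aw bw) ac bc wc)))
common-neighbour-K₄ (sorted ab ac bc) (inj₁ aw) (inj₂ wb) (inj₂ wc) = inj₂ (inj₁ (sorted-K₄ (sorted aw ab wb) ac wc bc))
common-neighbour-K₄ (sorted ab ac bc) (inj₂ wa) (inj₂ wb) (inj₂ wc) = inj₁ (sorted-K₄ (sorted wa wb ab) wc ac bc)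
common-neighbour-K₄ (sorted ab ac bc) (inj₁ aw) (inj₂ wb) (inj₁ cw) = ⊥-elim (no-cycle wb bc cw)
common-neighbour-K₄ (sorted ab ac bc) (inj₂ wa) (inj₁ bw) _         = ⊥-elim (no-cycle wa ab bw)
common-neighbour-K₄ (sorted ab ac bc) (inj₂ wa) (inj₂ wb) (inj₁ cw) = ⊥-elim (no-cycle wa ac cw)

maxTriangle-noCommonNeighbour : MaxTriangle k a b c → Adjacent k a w → Adjacent k b w → Adjacent k c w → ⊥
maxTriangle-noCommonNeighbour t aw bw cw with common-neighbour-K₄ (maxTriangle-sorted t) aw bw cw
maxTriangle-noCommonNeighbour () _ _ _ | inj₁ w₁w₄vz
maxTriangle-noCommonNeighbour () _ _ _ | inj₂ (inj₁ w₁w₄vz)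
maxTriangle-noCommonNeighbour () _ _ _ | inj₂ (inj₂ (inj₁ w₁w₄vz))
maxTriangle-noCommonNeighbour () _ _ _ | inj₂ (inj₂ (inj₂ w₁w₄vz))

record OnK₄ (k a b c : ℕ) : Set where
  field
    fourth   : ℕ
    a∼fourth : Adjacent k a fourth
    b∼fourth : Adjacent k b fourth
    c∼fourth : Adjacent k c fourth
    unique   : ∀ {w} → Adjacent k a w → Adjacent k b w → Adjacent k c w → w ≡ fourth

k₄Triangle-onK₄ : K₄Triangle k a b c → OnK₄ k a b c
k₄Triangle-onK₄ {k} t = record
  { fourth = fourth t ; a∼fourth = proj₁ (fourth-adjacent t) ; b∼fourth = proj₁ (proj₂ (fourth-adjacent t))
  ; c∼fourth = proj₂ (proj₂ (fourth-adjacent t)) ; unique = unique t }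
  where
    fourth : ∀ {a b c} → K₄Triangle k a b c → ℕ
    fourth w₁w₄v = 8 + k
    fourth w₁w₄z = 6 + k
    fourth w₁vz  = 4
    fourth w₄vz  = 1
    fourth-adjacent : ∀ {a b c} (t : K₄Triangle k a b c)
                    → Adjacent k a (fourth t) × Adjacent k b (fourth t) × Adjacent k c (fourth t)
    fourth-adjacent w₁w₄v = inj₁ w₁z , inj₁ w₄z , inj₁ vz
    fourth-adjacent w₁w₄z = inj₁ (w₁v _ ≤-refl) , inj₁ w₄v′ , inj₂ vz
    fourth-adjacent w₁vz  = inj₁ w₁w₄ , inj₂ w₄v′ , inj₂ w₄z
    fourth-adjacent w₄vz  = inj₂ w₁w₄ , inj₂ (w₁v _ ≤-refl) , inj₂ w₁z
    unique : ∀ {a b c w} (t : K₄Triangle k a b c) → Adjacent k a w → Adjacent k b w → Adjacent k c w → w ≡ fourth t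
    unique t aw bw cw with common-neighbour-K₄ (k₄Triangle-sorted t) aw bw cw
    unique w₁w₄v _ _ _ | inj₂ (inj₂ (inj₂ w₁w₄vz)) = refl
    unique w₁w₄z _ _ _ | inj₂ (inj₂ (inj₁ w₁w₄vz)) = refl
    unique w₁vz  _ _ _ | inj₂ (inj₁ w₁w₄vz)        = refl
    unique w₁vz  _ _ _ | inj₂ (inj₂ (inj₁ ()))
    unique w₁vz  _ _ _ | inj₂ (inj₂ (inj₂ ()))
    unique w₄vz  _ _ _ | inj₁ w₁w₄vz               = refl
    unique w₄vz  _ _ _ | inj₂ (inj₁ ())
    unique w₄vz  _ _ _ | inj₂ (inj₂ (inj₁ ()))
    unique w₄vz  _ _ _ | inj₂ (inj₂ (inj₂ ()))

maxTriangle-irrelevant : (s t : MaxTriangle k a b c) → s ≡ t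
maxTriangle-irrelevant w₀w₁w₂ w₀w₁w₂ = refl
maxTriangle-irrelevant w₀w₁w₄ w₀w₁w₄ = refl
maxTriangle-irrelevant w₀w₂w₃ w₀w₂w₃ = refl
maxTriangle-irrelevant w₀w₃w₄ w₀w₃w₄ = refl
maxTriangle-irrelevant w₁w₂v  w₁w₂v  = refl
maxTriangle-irrelevant (w₁vv j p) (w₁vv .j q) = cong (w₁vv j) (≤-irrelevant p q)
maxTriangle-irrelevant vvv    vvv    = refl
maxTriangle-irrelevant w₄vv   w₄vv   = refl
maxTriangle-irrelevant w₃w₄v  w₃w₄v  = refl

Label : ℕ → ℕ → Set
Label k a = a ≤ 8 + k

edge-label : Edge k a b → Label k b
edge-label w₀w₁      = s≤s z≤n
edge-label w₀w₂      = s≤s (s≤s z≤n)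
edge-label w₀w₃      = s≤s (s≤s (s≤s z≤n))
edge-label w₀w₄      = s≤s (s≤s (s≤s (s≤s z≤n)))
edge-label w₁w₂      = s≤s (s≤s z≤n)
edge-label w₁w₄      = s≤s (s≤s (s≤s (s≤s z≤n)))
edge-label w₂w₃      = s≤s (s≤s (s≤s z≤n))
edge-label w₃w₄      = s≤s (s≤s (s≤s (s≤s z≤n)))
edge-label (vv _ j<)  = +-monoʳ-≤ 6 (<⇒≤ j<)
edge-label (w₁v _ j<) = +-monoʳ-≤ 5 (≤-trans (<⇒≤ j<) (n≤1+n _))
edge-label vv′       = +-monoʳ-≤ 7 (n≤1+n _)
edge-label w₂v       = s≤s (s≤s (s≤s (s≤s (s≤s z≤n))))
edge-label w₃v       = +-monoʳ-≤ 7 (n≤1+n _)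
edge-label w₄v′      = +-monoʳ-≤ 6 (m≤n+m _ 2)
edge-label w₄v       = +-monoʳ-≤ 7 (n≤1+n _)
edge-label w₁z       = ≤-refl
edge-label w₄z       = ≤-refl
edge-label vz        = ≤-refl

adjacent-labels : Adjacent k a b → Label k a × Label k b
adjacent-labels (inj₁ e) = ≤-trans (<⇒≤ (Edge⇒< e)) (edge-label e) , edge-label e
adjacent-labels (inj₂ e) = edge-label e , ≤-trans (<⇒≤ (Edge⇒< e)) (edge-label e)

sorted-labels : Sorted k a b c → Label k a × Label k b × Label k c
sorted-labels (sorted ab ac bc) = proj₁ (adjacent-labels (inj₁ ab)) , proj₁ (adjacent-labels (inj₁ bc)) , edge-label bc

neighbour : Label k a → ∃[ b ] Adjacent k a b
neighbour {a = 0} _ = 1 , inj₁ w₀w₁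
neighbour {a = 1} _ = 0 , inj₂ w₀w₁
neighbour {a = 2} _ = 0 , inj₂ w₀w₂
neighbour {a = 3} _ = 0 , inj₂ w₀w₃
neighbour {a = 4} _ = 0 , inj₂ w₀w₄
neighbour {k} {suc (suc (suc (suc (suc j))))} (s≤s (s≤s (s≤s (s≤s (s≤s j≤3+k))))) with j <? 2 + k | m≤n⇒m<n∨m≡n j≤3+k
... | yes j< | _ = 1 , inj₂ (w₁v j j<)
... | no  _  | inj₂ refl = 1 , inj₂ w₁z
... | no  j≮ | inj₁ j<3+k with ≤-antisym (≤-pred j<3+k) (≮⇒≥ j≮)
...   | refl = 3 , inj₂ w₃v

commonNeighbour : Edge k a b → ∃[ c ] (Adjacent k a c × Adjacent k b c)
commonNeighbour w₀w₁ = 2 , inj₁ w₀w₂ , inj₁ w₁w₂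
commonNeighbour w₀w₂ = 1 , inj₁ w₀w₁ , inj₂ w₁w₂
commonNeighbour w₀w₃ = 2 , inj₁ w₀w₂ , inj₂ w₂w₃
commonNeighbour w₀w₄ = 1 , inj₁ w₀w₁ , inj₂ w₁w₄
commonNeighbour w₁w₂ = 0 , inj₂ w₀w₁ , inj₂ w₀w₂
commonNeighbour w₁w₄ = 0 , inj₂ w₀w₁ , inj₂ w₀w₄
commonNeighbour w₂w₃ = 0 , inj₂ w₀w₂ , inj₂ w₀w₃
commonNeighbour w₃w₄ = 0 , inj₂ w₀w₃ , inj₂ w₀w₄
commonNeighbour {k} (vv j j<) with j ≤? k
... | yes j≤k = 1 , inj₂ (w₁v j j<) , inj₂ (w₁v (suc j) (s≤s (s≤s j≤k)))
... | no  j≰k with ≤-antisym (≤-pred j<) (≰⇒> j≰k)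
...   | refl = 4 , inj₂ w₄v′ , inj₂ w₄v
commonNeighbour (w₁v 0 _) = 2 , inj₁ w₁w₂ , inj₂ w₂v
commonNeighbour (w₁v (suc j) j<) = 5 + j , inj₁ (w₁v j (<-trans (n<1+n _) j<)) , inj₂ (vv j (<-trans (n<1+n _) j<))
commonNeighbour vv′  = 6 + _ , inj₁ (vv _ (s≤s (n≤1+n _))) , inj₂ (vv _ ≤-refl)
commonNeighbour w₂v  = 1 , inj₂ w₁w₂ , inj₂ (w₁v 0 (s≤s z≤n))
commonNeighbour w₃v  = 4 , inj₁ w₃w₄ , inj₂ w₄v
commonNeighbour w₄v′ = 7 + _ , inj₁ w₄v , inj₁ (vv _ ≤-refl)
commonNeighbour w₄v  = 3 , inj₂ w₃w₄ , inj₂ w₃v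
commonNeighbour w₁z  = 4 , inj₁ w₁w₄ , inj₂ w₄z
commonNeighbour w₄z  = 1 , inj₂ w₁w₄ , inj₂ w₁z
commonNeighbour vz   = 1 , inj₂ (w₁v _ ≤-refl) , inj₂ w₁z

-- A maximal triangle spanned by the edge p < q and a third vertex v, by the position of v.
data MaxTriangleOn (k : ℕ) : ℕ → ℕ → ℕ → Set where
  last   : MaxTriangle k a b c → MaxTriangleOn k a b c
  middle : MaxTriangle k a b c → MaxTriangleOn k a c b
  first  : MaxTriangle k a b c → MaxTriangleOn k b c a

onK₄-swap₂₃ : OnK₄ k a b c → OnK₄ k a c b
onK₄-swap₂₃ o = record { a∼fourth = a∼fourth ; b∼fourth = c∼fourth ; c∼fourth = b∼fourth
                       ; unique = λ aw cw bw → unique aw bw cw }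
  where open OnK₄ o

onK₄-rotate : OnK₄ k a b c → OnK₄ k b c a
onK₄-rotate o = record { a∼fourth = b∼fourth ; b∼fourth = c∼fourth ; c∼fourth = a∼fourth
                       ; unique = λ bw cw aw → unique aw bw cw }
  where open OnK₄ o

classify-apex : Edge k p q → Adjacent k p v → Adjacent k q v → MaxTriangleOn k p q v ⊎ OnK₄ k p q v
classify-apex pq (inj₁ pv) (inj₁ qv) with classify pq pv qv
... | inj₁ t = inj₁ (last t)
... | inj₂ t = inj₂ (k₄Triangle-onK₄ t)
classify-apex pq (inj₁ pv) (inj₂ vq) with classify pv pq vq
... | inj₁ t = inj₁ (middle t)
... | inj₂ t = inj₂ (onK₄-swap₂₃ (k₄Triangle-onK₄ t))
classify-apex pq (inj₂ vp) (inj₂ vq) with classify vp vq pq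
... | inj₁ t = inj₁ (first t)
... | inj₂ t = inj₂ (onK₄-rotate (k₄Triangle-onK₄ t))
classify-apex pq (inj₂ vp) (inj₁ qv) = ⊥-elim (no-cycle vp pq qv)

record MaxTri (k : ℕ) : Set where
  constructor ⟨_⟩
  field
    {x₁ x₂ x₃} : ℕ
    triangle : MaxTriangle k x₁ x₂ x₃

-- consecutive maximal triangles, in the order of the paths of θ₂,₂,ℓ from w₀w₁w₂ to w₀w₃w₄
data Next (k : ℕ) : MaxTri k → MaxTri k → Set where
  w₀w₁w₂→w₀w₁w₄ : Next k ⟨ w₀w₁w₂ ⟩ ⟨ w₀w₁w₄ ⟩
  w₀w₁w₄→w₀w₃w₄ : Next k ⟨ w₀w₁w₄ ⟩ ⟨ w₀w₃w₄ ⟩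
  w₀w₁w₂→w₀w₂w₃ : Next k ⟨ w₀w₁w₂ ⟩ ⟨ w₀w₂w₃ ⟩
  w₀w₂w₃→w₀w₃w₄ : Next k ⟨ w₀w₂w₃ ⟩ ⟨ w₀w₃w₄ ⟩
  w₀w₁w₂→w₁w₂v  : Next k ⟨ w₀w₁w₂ ⟩ ⟨ w₁w₂v ⟩
  w₁w₂v→w₁vv    : ∀ {p} → Next k ⟨ w₁w₂v ⟩ ⟨ w₁vv 0 p ⟩
  w₁vv→w₁vv     : ∀ {j p q} → Next k ⟨ w₁vv j p ⟩ ⟨ w₁vv (suc j) q ⟩
  w₁vv→vvv      : ∀ {p} → Next k ⟨ w₁vv k p ⟩ ⟨ vvv ⟩
  vvv→w₄vv      : Next k ⟨ vvv ⟩ ⟨ w₄vv ⟩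
  w₄vv→w₃w₄v    : Next k ⟨ w₄vv ⟩ ⟨ w₃w₄v ⟩
  w₃w₄v→w₀w₃w₄  : Next k ⟨ w₃w₄v ⟩ ⟨ w₀w₃w₄ ⟩

triangleOn : MaxTriangleOn k p q v → MaxTri k
triangleOn (last t)   = ⟨ t ⟩
triangleOn (middle t) = ⟨ t ⟩
triangleOn (first t)  = ⟨ t ⟩

Neighbours : MaxTri k → MaxTri k → Set
Neighbours {k} t t′ = Next k t t′ ⊎ Next k t′ t

-- Replacing the vertex x of the maximal triangle t by an apex v over the remaining edge
-- gives t again or a neighbour of t.
SwapOutcome : ℕ → MaxTri k → MaxTriangleOn k p q v → Set
SwapOutcome {v = v} x t on = v ≡ x ⊎ Neighbours t (triangleOn on)

pattern same   = inj₁ refl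
pattern next e = inj₂ (inj₁ e)
pattern prev e = inj₂ (inj₂ e)

replace-first : (t : MaxTriangle k a b c) (on : MaxTriangleOn k b c v) → SwapOutcome a ⟨ t ⟩ on
replace-first w₀w₁w₂ (last w₁w₂v) = next w₀w₁w₂→w₁w₂v
replace-first w₀w₁w₂ (first w₀w₁w₂) = same
replace-first w₀w₁w₄ (first w₀w₁w₄) = same
replace-first w₀w₂w₃ (first w₀w₂w₃) = same
replace-first w₀w₃w₄ (last w₃w₄v) = prev w₃w₄v→w₀w₃w₄
replace-first w₀w₃w₄ (first w₀w₃w₄) = same
replace-first w₁w₂v (first w₁w₂v) = same
replace-first (w₁vv j p) (last vvv) = next w₁vv→vvv
replace-first (w₁vv j p) (first (w₁vv .j _)) = same
replace-first (w₁vv j p) (first w₄vv) = ⊥-elim (n≮n _ p)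
replace-first (w₁vv j p) (first vvv) = ⊥-elim (n≮n _ p)
replace-first vvv (first vvv) = same
replace-first vvv (first w₄vv) = next vvv→w₄vv
replace-first vvv (first (w₁vv _ p)) = ⊥-elim (n≮n _ p)
replace-first w₄vv (first vvv) = prev vvv→w₄vv
replace-first w₄vv (first w₄vv) = same
replace-first w₄vv (first (w₁vv _ p)) = ⊥-elim (n≮n _ p)
replace-first w₃w₄v (first w₃w₄v) = same
replace-first w₃w₄v (middle w₄vv) = prev w₄vv→w₃w₄v

replace-middle : (t : MaxTriangle k a b c) (on : MaxTriangleOn k a c v) → SwapOutcome b ⟨ t ⟩ on
replace-middle w₀w₁w₂ (middle w₀w₁w₂) = same
replace-middle w₀w₁w₂ (last w₀w₂w₃) = next w₀w₁w₂→w₀w₂w₃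
replace-middle w₀w₁w₄ (middle w₀w₁w₄) = same
replace-middle w₀w₁w₄ (middle w₀w₃w₄) = next w₀w₁w₄→w₀w₃w₄
replace-middle w₀w₂w₃ (middle w₀w₂w₃) = same
replace-middle w₀w₂w₃ (last w₀w₃w₄) = next w₀w₂w₃→w₀w₃w₄
replace-middle w₀w₃w₄ (middle w₀w₃w₄) = same
replace-middle w₀w₃w₄ (middle w₀w₁w₄) = prev w₀w₁w₄→w₀w₃w₄
replace-middle w₁w₂v (middle w₁w₂v) = same
replace-middle w₁w₂v (last (w₁vv .0 _)) = next w₁w₂v→w₁vv
replace-middle (w₁vv j p) (last (w₁vv _ _)) = next w₁vv→w₁vv
replace-middle (w₁vv j p) (middle (w₁vv .j _)) = same
replace-middle vvv (middle vvv) = same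
replace-middle w₄vv (middle w₄vv) = same
replace-middle w₄vv (first w₃w₄v) = next w₄vv→w₃w₄v
replace-middle w₃w₄v (middle w₃w₄v) = same

replace-last : (t : MaxTriangle k a b c) (on : MaxTriangleOn k a b v) → SwapOutcome c ⟨ t ⟩ on
replace-last w₀w₁w₂ (last w₀w₁w₂) = same
replace-last w₀w₁w₂ (last w₀w₁w₄) = next w₀w₁w₂→w₀w₁w₄
replace-last w₀w₁w₄ (last w₀w₁w₂) = prev w₀w₁w₂→w₀w₁w₄
replace-last w₀w₁w₄ (last w₀w₁w₄) = same
replace-last w₀w₂w₃ (last w₀w₂w₃) = same
replace-last w₀w₂w₃ (middle w₀w₁w₂) = prev w₀w₁w₂→w₀w₂w₃
replace-last w₀w₃w₄ (last w₀w₃w₄) = same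
replace-last w₀w₃w₄ (middle w₀w₂w₃) = prev w₀w₂w₃→w₀w₃w₄
replace-last w₁w₂v (last w₁w₂v) = same
replace-last w₁w₂v (first w₀w₁w₂) = prev w₀w₁w₂→w₁w₂v
replace-last (w₁vv j p) (last (w₁vv .j _)) = same
replace-last (w₁vv .0 p) (middle w₁w₂v) = prev w₁w₂v→w₁vv
replace-last (w₁vv _ p) (middle (w₁vv _ _)) = prev w₁vv→w₁vv
replace-last vvv (last vvv) = same
replace-last vvv (first (w₁vv _ _)) = prev w₁vv→vvv
replace-last w₄vv (last w₄vv) = same
replace-last w₃w₄v (last w₃w₄v) = same
replace-last w₃w₄v (first w₀w₃w₄) = next w₃w₄v→w₀w₃w₄

maxTriangleOn-noCommonNeighbour : ∀ {w} → MaxTriangleOn k p q v → Adjacent k p w → Adjacent k q w → Adjacent k v w → ⊥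
maxTriangleOn-noCommonNeighbour (last t)   pw qw vw = maxTriangle-noCommonNeighbour t pw qw vw
maxTriangleOn-noCommonNeighbour (middle t) pw qw vw = maxTriangle-noCommonNeighbour t pw vw qw
maxTriangleOn-noCommonNeighbour (first t)  pw qw vw = maxTriangle-noCommonNeighbour t vw pw qw

⟨⟩-≡ : ∀ {a′ b′ c′} (s : MaxTriangle k a b c) (t : MaxTriangle k a′ b′ c′) → a ≡ a′ → b ≡ b′ → c ≡ c′ → ⟨ s ⟩ ≡ ⟨ t ⟩
⟨⟩-≡ s t refl refl refl = cong ⟨_⟩ (maxTriangle-irrelevant s t)

-- the maximal triangles at the interior positions 0, …, k + 4 of the long path of θ₂,₂,₆₊ₖ
data LongPosition (k : ℕ) : ℕ → Set where
  at-w₁w₂v : LongPosition k 0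
  at-w₁vv  : ∀ {j} → j ≤ k → LongPosition k (suc j)
  at-vvv   : LongPosition k (2 + k)
  at-w₄vv  : LongPosition k (3 + k)
  at-w₃w₄v : LongPosition k (4 + k)

longTriangle : LongPosition k n → MaxTri k
longTriangle at-w₁w₂v      = ⟨ w₁w₂v ⟩
longTriangle (at-w₁vv j≤k) = ⟨ w₁vv _ j≤k ⟩
longTriangle at-vvv        = ⟨ vvv ⟩
longTriangle at-w₄vv       = ⟨ w₄vv ⟩
longTriangle at-w₃w₄v      = ⟨ w₃w₄v ⟩

longPosition< : LongPosition k n → n < 5 + k
longPosition< at-w₁w₂v      = s≤s z≤n
longPosition< (at-w₁vv j≤k) = s≤s (s≤s (≤-trans j≤k (m≤n+m _ 3)))
longPosition< at-vvv        = s≤s (s≤s (s≤s (m≤n+m _ 2)))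
longPosition< at-w₄vv       = s≤s (s≤s (s≤s (s≤s (m≤n+m _ 1))))
longPosition< at-w₃w₄v      = ≤-refl

longPosition : n < 5 + k → LongPosition k n
longPosition {0} _ = at-w₁w₂v
longPosition {suc j} {k} (s≤s j<4+k) with j ≤? k
... | yes j≤k = at-w₁vv j≤k
... | no  j≰k with m≤n⇒m<n∨m≡n (≤-pred j<4+k)
...   | inj₂ refl = at-w₃w₄v
...   | inj₁ j<3+k with m≤n⇒m<n∨m≡n (≤-pred j<3+k)
...     | inj₂ refl = at-w₄vv
...     | inj₁ j<2+k with ≤-antisym (≤-pred j<2+k) (≰⇒> j≰k)
...       | refl = at-vvv

longPosition-irrelevant : (p q : LongPosition k n) → p ≡ q
longPosition-irrelevant at-w₁w₂v      at-w₁w₂v      = refl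
longPosition-irrelevant (at-w₁vv p)   (at-w₁vv q)   = cong at-w₁vv (≤-irrelevant p q)
longPosition-irrelevant (at-w₁vv p)   at-vvv        = ⊥-elim (n≮n _ p)
longPosition-irrelevant (at-w₁vv p)   at-w₄vv       = ⊥-elim (m+n≮n 1 _ p)
longPosition-irrelevant (at-w₁vv p)   at-w₃w₄v      = ⊥-elim (m+n≮n 2 _ p)
longPosition-irrelevant at-vvv        (at-w₁vv q)   = ⊥-elim (n≮n _ q)
longPosition-irrelevant at-vvv        at-vvv        = refl
longPosition-irrelevant at-w₄vv       (at-w₁vv q)   = ⊥-elim (m+n≮n 1 _ q)
longPosition-irrelevant at-w₄vv       at-w₄vv       = refl
longPosition-irrelevant at-w₃w₄v      (at-w₁vv q)   = ⊥-elim (m+n≮n 2 _ q)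
longPosition-irrelevant at-w₃w₄v      at-w₃w₄v      = refl

longPosition-next : (p : LongPosition k n) (q : LongPosition k (suc n)) → Next k (longTriangle p) (longTriangle q)
longPosition-next at-w₁w₂v    (at-w₁vv _) = w₁w₂v→w₁vv
longPosition-next (at-w₁vv _) (at-w₁vv _) = w₁vv→w₁vv
longPosition-next (at-w₁vv _) at-vvv      = w₁vv→vvv
longPosition-next (at-w₁vv p) at-w₄vv     = ⊥-elim (n≮n _ p)
longPosition-next (at-w₁vv p) at-w₃w₄v    = ⊥-elim (m+n≮n 1 _ p)
longPosition-next at-vvv      (at-w₁vv q) = ⊥-elim (m+n≮n 1 _ q)
longPosition-next at-vvv      at-w₄vv     = vvv→w₄vv
longPosition-next at-w₄vv     (at-w₁vv q) = ⊥-elim (m+n≮n 2 _ q)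
longPosition-next at-w₄vv     at-w₃w₄v    = w₄vv→w₃w₄v
longPosition-next at-w₃w₄v    (at-w₁vv q) = ⊥-elim (m+n≮n 3 _ q)

module ThetaCorrespondence (k : ℕ) where
  open Theta₂₂ (4 + k)

  longAt : n < 5 + k → Vertex
  longAt n< = long (fromℕ< n<)

  triangleAt : Vertex → MaxTri k
  triangleAt endA     = ⟨ w₀w₁w₂ ⟩
  triangleAt endB     = ⟨ w₀w₃w₄ ⟩
  triangleAt mid₀     = ⟨ w₀w₁w₄ ⟩
  triangleAt mid₁     = ⟨ w₀w₂w₃ ⟩
  triangleAt (long s) = longTriangle (longPosition (toℕ<n s))

  position : MaxTri k → Vertex
  position ⟨ w₀w₁w₂ ⟩     = endA
  position ⟨ w₀w₃w₄ ⟩     = endB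
  position ⟨ w₀w₁w₄ ⟩     = mid₀
  position ⟨ w₀w₂w₃ ⟩     = mid₁
  position ⟨ w₁w₂v ⟩      = longAt (longPosition< (at-w₁w₂v {k}))
  position ⟨ w₁vv _ j≤k ⟩ = longAt (longPosition< (at-w₁vv j≤k))
  position ⟨ vvv ⟩        = longAt (longPosition< (at-vvv {k}))
  position ⟨ w₄vv ⟩       = longAt (longPosition< (at-w₄vv {k}))
  position ⟨ w₃w₄v ⟩      = longAt (longPosition< (at-w₃w₄v {k}))

  triangleAt-long : ∀ s → toℕ s ≡ n → (p : LongPosition k n) → triangleAt (long s) ≡ longTriangle p
  triangleAt-long s refl p = cong longTriangle (longPosition-irrelevant _ p)

  triangleAt-longAt : (p : LongPosition k n) → triangleAt (longAt (longPosition< p)) ≡ longTriangle p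
  triangleAt-longAt p = triangleAt-long _ (toℕ-fromℕ< (longPosition< p)) p

  position-longTriangle : (p : LongPosition k n) → position (longTriangle p) ≡ longAt (longPosition< p)
  position-longTriangle at-w₁w₂v    = refl
  position-longTriangle (at-w₁vv _) = refl
  position-longTriangle at-vvv      = refl
  position-longTriangle at-w₄vv     = refl
  position-longTriangle at-w₃w₄v    = refl

  position∘triangleAt : ∀ x → position (triangleAt x) ≡ x
  position∘triangleAt endA     = refl
  position∘triangleAt endB     = refl
  position∘triangleAt mid₀     = refl
  position∘triangleAt mid₁     = refl
  position∘triangleAt (long s) = trans (position-longTriangle (longPosition (toℕ<n s)))
    (cong long (toℕ-injective (toℕ-fromℕ< _)))

  triangleAt∘position : ∀ t → triangleAt (position t) ≡ t
  triangleAt∘position ⟨ w₀w₁w₂ ⟩     = refl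
  triangleAt∘position ⟨ w₀w₃w₄ ⟩     = refl
  triangleAt∘position ⟨ w₀w₁w₄ ⟩     = refl
  triangleAt∘position ⟨ w₀w₂w₃ ⟩     = refl
  triangleAt∘position ⟨ w₁w₂v ⟩      = triangleAt-longAt at-w₁w₂v
  triangleAt∘position ⟨ w₁vv _ j≤k ⟩ = triangleAt-longAt (at-w₁vv j≤k)
  triangleAt∘position ⟨ vvv ⟩        = triangleAt-longAt at-vvv
  triangleAt∘position ⟨ w₄vv ⟩       = triangleAt-longAt at-w₄vv
  triangleAt∘position ⟨ w₃w₄v ⟩      = triangleAt-longAt at-w₃w₄v

  step⇒next : ∀ {x y} → Step x y → Next k (triangleAt x) (triangleAt y)
  step⇒next a→mid₀ = w₀w₁w₂→w₀w₁w₄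
  step⇒next mid₀→b = w₀w₁w₄→w₀w₃w₄
  step⇒next a→mid₁ = w₀w₁w₂→w₀w₂w₃
  step⇒next mid₁→b = w₀w₂w₃→w₀w₃w₄
  step⇒next a→long = w₀w₁w₂→w₁w₂v
  step⇒next (long→long s t t≡1+s) =
    subst (Next k _) (sym (triangleAt-long t t≡1+s at-t)) (longPosition-next (longPosition (toℕ<n s)) at-t)
    where at-t = longPosition (subst (_< 5 + k) t≡1+s (toℕ<n t))
  step⇒next (long→b s s≡4+k) = subst (λ t → Next k t _) (sym (triangleAt-long s s≡4+k at-w₃w₄v)) w₃w₄v→w₀w₃w₄

  longPosition-step : (p : LongPosition k n) (q : LongPosition k (suc n))
                    → Step (longAt (longPosition< p)) (longAt (longPosition< q))
  longPosition-step p q =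
    long→long _ _ (trans (toℕ-fromℕ< (longPosition< q)) (cong suc (sym (toℕ-fromℕ< (longPosition< p)))))

  next⇒step : ∀ {t t′} → Next k t t′ → Step (position t) (position t′)
  next⇒step w₀w₁w₂→w₀w₁w₄           = a→mid₀
  next⇒step w₀w₁w₄→w₀w₃w₄           = mid₀→b
  next⇒step w₀w₁w₂→w₀w₂w₃           = a→mid₁
  next⇒step w₀w₂w₃→w₀w₃w₄           = mid₁→b
  next⇒step w₀w₁w₂→w₁w₂v            = a→long
  next⇒step (w₁w₂v→w₁vv {p})        = longPosition-step at-w₁w₂v (at-w₁vv p)
  next⇒step (w₁vv→w₁vv {p = p} {q}) = longPosition-step (at-w₁vv p) (at-w₁vv q)
  next⇒step (w₁vv→vvv {p})          = longPosition-step (at-w₁vv p) at-vvv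
  next⇒step vvv→w₄vv                = longPosition-step at-vvv at-w₄vv
  next⇒step w₄vv→w₃w₄v              = longPosition-step at-w₄vv at-w₃w₄v
  next⇒step w₃w₄v→w₀w₃w₄            = long→b _ (toℕ-fromℕ< (longPosition< (at-w₃w₄v {k})))

-- The case ℓ ≥ 6: i-sets

module CaseA (k : ℕ) where

  N : ℕ
  N = k + 9

  label< : ∀ {a} → Label k a → a < N
  label< {a} a≤ = subst (a <_) (+-comm 9 k) (s≤s a≤)

  -- labels beyond the vertex range are sent to w₀; they never occur
  F : ℕ → Fin N
  F a with a <? N
  ... | yes a<N = fromℕ< a<N
  ... | no  _   = fromℕ< (label< {0} z≤n)

  toℕ-F : ∀ {a} → Label k a → toℕ (F a) ≡ a
  toℕ-F {a} a≤ with a <? N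
  ... | yes a<N = toℕ-fromℕ< a<N
  ... | no  a≮N = ⊥-elim (a≮N (label< a≤))

  label-toℕ : ∀ u → Label k (toℕ u)
  label-toℕ u = ≤-pred (subst (toℕ u <_) (+-comm k 9) (toℕ<n u))

  F-toℕ : ∀ u → F (toℕ u) ≡ u
  F-toℕ u = toℕ-injective (toℕ-F (label-toℕ u))

  F-injective : ∀ {a b} → Label k a → Label k b → F a ≡ F b → a ≡ b
  F-injective a≤ b≤ e = trans (sym (toℕ-F a≤)) (trans (cong toℕ e) (toℕ-F b≤))

  _∼_ : Fin N → Fin N → Set
  u ∼ v = Adjacent k (toℕ u) (toℕ v)

  open ComplementOf (Gbar-a k) _∼_ (adjacent⇔adj k) (λ _ → Adjacent-irrefl) Adjacent-sym public

  ∼-F : ∀ {a b} → Adjacent k a b → F a ∼ F b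
  ∼-F {a} {b} ab = subst₂ (Adjacent k) (sym (toℕ-F a≤)) (sym (toℕ-F b≤)) ab
    where
      a≤ = proj₁ (adjacent-labels ab)
      b≤ = proj₂ (adjacent-labels ab)

  F-∼ : ∀ {a w} → Label k a → F a ∼ w → Adjacent k a (toℕ w)
  F-∼ a≤ aw = subst (λ x → Adjacent k x _) (toℕ-F a≤) aw

  F∼F⇒adjacent : ∀ {a b} → Label k a → Label k b → F a ∼ F b → Adjacent k a b
  F∼F⇒adjacent a≤ b≤ = subst₂ (Adjacent k) (toℕ-F a≤) (toℕ-F b≤)

  adjacent-F : ∀ {a b} → Adjacent k a b → Adjacent k a (toℕ (F b))
  adjacent-F ab = subst (Adjacent k _) (sym (toℕ-F (proj₂ (adjacent-labels ab)))) ab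

  Φ : MaxTri k → Subset N
  Φ (⟨_⟩ {a} {b} {c} _) = triple (F a) (F b) (F c)

  Φ-indepDom : ∀ t → IndepDom G (Φ t)
  Φ-indepDom ⟨ t ⟩ = triple-indepDom (∼-F (inj₁ ab)) (∼-F (inj₁ ac)) (∼-F (inj₁ bc))
    λ w aw bw cw → maxTriangle-noCommonNeighbour t (F-∼ a≤ aw) (F-∼ b≤ bw) (F-∼ c≤ cw)
    where
      open Sorted (maxTriangle-sorted t)
      a≤ = proj₁ (sorted-labels (maxTriangle-sorted t))
      b≤ = proj₁ (proj₂ (sorted-labels (maxTriangle-sorted t)))
      c≤ = proj₂ (proj₂ (sorted-labels (maxTriangle-sorted t)))

  ∣Φ∣≤3 : ∀ t → ∣ Φ t ∣ ≤ 3
  ∣Φ∣≤3 (⟨_⟩ {a} {b} {c} _) = ∣triple∣≤3 (F a) (F b) (F c)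

  findTriangle : ∀ {Y} → IndepDom G Y → TriangleIn Y
  findTriangle = triangleIn neighbourᶠ commonNeighbourᶠ (F 0)
    where
      neighbourᶠ : ∀ u → ∃[ v ] u ∼ v
      neighbourᶠ u = F _ , adjacent-F (proj₂ (neighbour (label-toℕ u)))
      commonNeighbourᶠ : ∀ {u v} → u ∼ v → ∃[ w ] (u ∼ w × v ∼ w)
      commonNeighbourᶠ (inj₁ uv) = let _ , uw , vw = commonNeighbour uv in F _ , adjacent-F uw , adjacent-F vw
      commonNeighbourᶠ (inj₂ vu) = let _ , vw , uw = commonNeighbour vu in F _ , adjacent-F uw , adjacent-F vw

  triangleOn-Φ : ∀ {p q v} (on : MaxTriangleOn k p q v) → Φ (triangleOn on) ≡ triple (F p) (F q) (F v)
  triangleOn-Φ (last _)   = refl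
  triangleOn-Φ (middle _) = trans (triple-rotate _ _ _) (triple-swap₁₂ _ _ _)
  triangleOn-Φ (first _)  = sym (triple-rotate _ _ _)

  -- An independent dominating set of size at most 3 containing an edge and a common neighbour
  -- of it is the maximal triangle they span: a triangle of the K₄ would force its fourth vertex in.
  spanned-iset : ∀ {X p q v} → IndepDom G X → ∣ X ∣ ≤ 3 → F p ∈ X → F q ∈ X → F v ∈ X
               → Edge k p q → Adjacent k p v → Adjacent k q v
               → Σ (MaxTriangleOn k p q v) λ on → Φ (triangleOn on) ≡ X
  spanned-iset {p = p} {q} {v} X-indepDom ∣X∣≤3 p∈ q∈ v∈ pq pv qv with classify-apex pq pv qv
  ... | inj₁ on = on , trans (triangleOn-Φ on) (indepDom⊇triple⇒≡ X-indepDom p∈ q∈ v∈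
          λ w pw qw vw → maxTriangleOn-noCommonNeighbour on (F-∼ p≤ pw) (F-∼ q≤ qw) (F-∼ v≤ vw))
    where
      p≤ = proj₁ (adjacent-labels pv)
      q≤ = proj₁ (adjacent-labels qv)
      v≤ = proj₂ (adjacent-labels pv)
  ... | inj₂ onK₄ = ⊥-elim (4≰3 (≤-trans
          (K₄⇒4≤∣indepDom∣ X-indepDom p∈ q∈ v∈ (∼-F (inj₁ pq)) (∼-F pv) (∼-F qv)
            (∼-F a∼fourth) (∼-F b∼fourth) (∼-F c∼fourth)
            λ w pw qw vw → trans (sym (F-toℕ w)) (cong F (unique (F-∼ p≤ pw) (F-∼ q≤ qw) (F-∼ v≤ vw))))
          ∣X∣≤3))
    where
      open OnK₄ onK₄
      p≤ = proj₁ (adjacent-labels pv)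
      q≤ = proj₁ (adjacent-labels qv)
      v≤ = proj₂ (adjacent-labels pv)
      4≰3 : ¬ 4 ≤ 3
      4≰3 (s≤s (s≤s (s≤s ())))

  onto : ∀ X → IndepDom G X → ∣ X ∣ ≤ 3 → ∃[ t ] Φ t ≡ X
  onto X X-indepDom ∣X∣≤3 = spanned x∼y
    where
      open TriangleIn (findTriangle X-indepDom)
      F-toℕ∈ : ∀ {u} → u ∈ X → F (toℕ u) ∈ X
      F-toℕ∈ {u} = subst (_∈ X) (sym (F-toℕ u))
      spanned : x ∼ y → ∃[ t ] Φ t ≡ X
      spanned (inj₁ xy) = mapΣ triangleOn id
        (spanned-iset X-indepDom ∣X∣≤3 (F-toℕ∈ x∈) (F-toℕ∈ y∈) (F-toℕ∈ z∈) xy x∼z y∼z)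
      spanned (inj₂ yx) = mapΣ triangleOn id
        (spanned-iset X-indepDom ∣X∣≤3 (F-toℕ∈ y∈) (F-toℕ∈ x∈) (F-toℕ∈ z∈) yx y∼z x∼z)

  Φ-injective : ∀ t t′ → Φ t ≡ Φ t′ → t ≡ t′
  Φ-injective ⟨ t ⟩ ⟨ t′ ⟩ eq =
    ⟨⟩-≡ t t′ (F-injective a≤ a′≤ Fa≡) (F-injective b≤ b′≤ Fb≡) (F-injective c≤ c′≤ Fc≡)
    where
      s = maxTriangle-sorted t
      s′ = maxTriangle-sorted t′
      a≤ = proj₁ (sorted-labels s)
      b≤ = proj₁ (proj₂ (sorted-labels s))
      c≤ = proj₂ (proj₂ (sorted-labels s))
      a′≤ = proj₁ (sorted-labels s′)
      b′≤ = proj₁ (proj₂ (sorted-labels s′))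
      c′≤ = proj₂ (proj₂ (sorted-labels s′))
      F-< : ∀ {x y} → Edge k x y → F x <ᶠ F y
      F-< xy = subst₂ _<_ (sym (toℕ-F (proj₁ (adjacent-labels (inj₁ xy))))) (sym (toℕ-F (edge-label xy)))
                          (Edge⇒< xy)
      equal = sorted-triple-injective (F-< (Sorted.ab s)) (F-< (Sorted.bc s)) (F-< (Sorted.ab s′)) (F-< (Sorted.bc s′))
                                      eq
      Fa≡ = proj₁ equal
      Fb≡ = proj₁ (proj₂ equal)
      Fc≡ = proj₂ (proj₂ equal)

  record SharedEdge (t t′ : MaxTri k) : Set where
    field
      {old e₁ e₂ new} : ℕ
      Φt    : Φ t ≡ triple (F old) (F e₁) (F e₂)
      Φt′   : Φ t′ ≡ triple (F new) (F e₁) (F e₂)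
      old∼e₁   : Adjacent k old e₁
      old∼e₂   : Adjacent k old e₂
      new∼e₁   : Adjacent k new e₁
      new∼e₂   : Adjacent k new e₂
      old≢new   : old ≢ new
      old≁new   : ¬ Adjacent k old new

  sharedEdge-swaps : ∀ {t t′} → SharedEdge t t′ → ISwap G (Φ t) (Φ t′) × ISwap G (Φ t′) (Φ t)
  sharedEdge-swaps s =
      subst₂ (ISwap G) (sym Φt) (sym Φt′)
        (swap-triple (∼⇒≢ (∼-F old∼e₁)) (∼⇒≢ (∼-F old∼e₂)) (∼⇒≢ (∼-F new∼e₁)) (∼⇒≢ (∼-F new∼e₂)) Fold≢Fnew
                     (old≁new ∘ F∼F⇒adjacent old≤ new≤))
    , subst₂ (ISwap G) (sym Φt′) (sym Φt)
        (swap-triple (∼⇒≢ (∼-F new∼e₁)) (∼⇒≢ (∼-F new∼e₂)) (∼⇒≢ (∼-F old∼e₁)) (∼⇒≢ (∼-F old∼e₂)) (Fold≢Fnew ∘ sym)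
                     (old≁new ∘ Adjacent-sym ∘ F∼F⇒adjacent new≤ old≤))
    where
      open SharedEdge s
      old≤ = proj₁ (adjacent-labels old∼e₁)
      new≤ = proj₁ (adjacent-labels new∼e₁)
      Fold≢Fnew : F old ≢ F new
      Fold≢Fnew = old≢new ∘ F-injective old≤ new≤

  next-sharedEdge : ∀ {t t′} → Next k t t′ → SharedEdge t t′
  next-sharedEdge w₀w₁w₂→w₀w₁w₄ = record
    { Φt = triple-rotate _ _ _ ; Φt′ = triple-rotate _ _ _
    ; old∼e₁ = inj₂ w₀w₂ ; old∼e₂ = inj₂ w₁w₂ ; new∼e₁ = inj₂ w₀w₄ ; new∼e₂ = inj₂ w₁w₄
    ; old≢new = λ () ; old≁new = [ (λ ()) , (λ ()) ] }
  next-sharedEdge w₀w₁w₄→w₀w₃w₄ = record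
    { Φt = triple-swap₁₂ _ _ _ ; Φt′ = triple-swap₁₂ _ _ _
    ; old∼e₁ = inj₂ w₀w₁ ; old∼e₂ = inj₁ w₁w₄ ; new∼e₁ = inj₂ w₀w₃ ; new∼e₂ = inj₁ w₃w₄
    ; old≢new = λ () ; old≁new = [ (λ ()) , (λ ()) ] }
  next-sharedEdge w₀w₁w₂→w₀w₂w₃ = record
    { Φt = triple-swap₁₂ _ _ _ ; Φt′ = triple-rotate _ _ _
    ; old∼e₁ = inj₂ w₀w₁ ; old∼e₂ = inj₁ w₁w₂ ; new∼e₁ = inj₂ w₀w₃ ; new∼e₂ = inj₂ w₂w₃
    ; old≢new = λ () ; old≁new = [ (λ ()) , (λ ()) ] }
  next-sharedEdge w₀w₂w₃→w₀w₃w₄ = record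
    { Φt = triple-swap₁₂ _ _ _ ; Φt′ = triple-rotate _ _ _
    ; old∼e₁ = inj₂ w₀w₂ ; old∼e₂ = inj₁ w₂w₃ ; new∼e₁ = inj₂ w₀w₄ ; new∼e₂ = inj₂ w₃w₄
    ; old≢new = λ () ; old≁new = [ (λ ()) , (λ ()) ] }
  next-sharedEdge w₀w₁w₂→w₁w₂v = record
    { Φt = refl ; Φt′ = triple-rotate _ _ _
    ; old∼e₁ = inj₁ w₀w₁ ; old∼e₂ = inj₁ w₀w₂ ; new∼e₁ = inj₂ (w₁v 0 (s≤s z≤n)) ; new∼e₂ = inj₂ w₂v
    ; old≢new = λ () ; old≁new = [ (λ ()) , (λ ()) ] }
  next-sharedEdge w₁w₂v→w₁vv = record
    { Φt = triple-swap₁₂ _ _ _ ; Φt′ = triple-rotate _ _ _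
    ; old∼e₁ = inj₂ w₁w₂ ; old∼e₂ = inj₁ w₂v ; new∼e₁ = inj₂ (w₁v 1 (s≤s (s≤s z≤n))) ; new∼e₂ = inj₂ (vv 0 (s≤s z≤n))
   
    ; old≢new = λ () ; old≁new = [ (λ ()) , (λ ()) ] }
  next-sharedEdge (w₁vv→w₁vv {j} {j≤k} {1+j≤k}) = record
    { Φt = triple-swap₁₂ _ _ _ ; Φt′ = triple-rotate _ _ _
    ; old∼e₁ = inj₂ (w₁v j (s≤s (≤-trans j≤k (n≤1+n _)))) ; old∼e₂ = inj₁ (vv j (s≤s (≤-trans j≤k (n≤1+n _))))
    ; new∼e₁ = inj₂ (w₁v (2 + j) (s≤s (s≤s 1+j≤k))) ; new∼e₂ = inj₂ (vv (suc j) (s≤s (s≤s j≤k)))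
   
    ; old≢new = λ () ; old≁new = [ (λ { vv′ → n≮n _ 1+j≤k ; vz → m+n≮n 1 _ 1+j≤k }) , (λ ()) ] }
  next-sharedEdge w₁vv→vvv = record
    { Φt = refl ; Φt′ = triple-rotate _ _ _
    ; old∼e₁ = inj₁ (w₁v k (s≤s (n≤1+n _))) ; old∼e₂ = inj₁ (w₁v (suc k) ≤-refl)
    ; new∼e₁ = inj₂ vv′ ; new∼e₂ = inj₂ (vv (suc k) ≤-refl)
   
    ; old≢new = λ () ; old≁new = [ (λ { (w₁v _ 2+k<2+k) → n≮n _ 2+k<2+k }) , (λ ()) ] }
  next-sharedEdge vvv→w₄vv = record
    { Φt = refl ; Φt′ = refl
    ; old∼e₁ = inj₁ (vv k (s≤s (n≤1+n _))) ; old∼e₂ = inj₁ vv′ ; new∼e₁ = inj₁ w₄v′ ; new∼e₂ = inj₁ w₄v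
   
    ; old≢new = λ () ; old≁new = [ (λ ()) , (λ ()) ] }
  next-sharedEdge w₄vv→w₃w₄v = record
    { Φt = triple-swap₁₂ _ _ _ ; Φt′ = refl
    ; old∼e₁ = inj₂ w₄v′ ; old∼e₂ = inj₁ (vv (suc k) ≤-refl) ; new∼e₁ = inj₁ w₃w₄ ; new∼e₂ = inj₁ w₃v
   
    ; old≢new = λ () ; old≁new = [ (λ ()) , (λ ()) ] }
  next-sharedEdge w₃w₄v→w₀w₃w₄ = record
    { Φt = triple-rotate _ _ _ ; Φt′ = refl
    ; old∼e₁ = inj₂ w₃v ; old∼e₂ = inj₂ w₄v ; new∼e₁ = inj₁ w₀w₃ ; new∼e₂ = inj₁ w₀w₄
    ; old≢new = λ () ; old≁new = [ (λ ()) , (λ ()) ] }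

  module SwapBetween {a b c} (t : MaxTriangle k a b c) (t′ : MaxTri k) (sw : ISwap G (Φ ⟨ t ⟩) (Φ t′)) where
    open SwapOf (swapOf sw)
    open Sorted (maxTriangle-sorted t)

    private
      new = toℕ added

      conclude : ∀ {p q x} (on : MaxTriangleOn k p q new) → Φ (triangleOn on) ≡ Φ t′ → F x ∈ Φ ⟨ t ⟩
               → SwapOutcome x ⟨ t ⟩ on → Neighbours ⟨ t ⟩ t′
      conclude on _  x∈ same     = ⊥-elim (added∉ (subst (_∈ Φ ⟨ t ⟩) (F-toℕ added) x∈))
      conclude on eq _  (next e) = inj₁ (subst (Next k ⟨ t ⟩) (Φ-injective _ _ eq) e)
      conclude on eq _  (prev e) = inj₂ (subst (λ s → Next k s ⟨ t ⟩) (Φ-injective _ _ eq) e)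

      kept∼added : ∀ {x} → Label k x → F x ∈ Φ ⟨ t ⟩ → F x ∈ Φ t′ → Adjacent k x new
      kept∼added x≤ x∈ x∈′ = F-∼ x≤ (independent⇒∼ (proj₁ (Φ-indepDom t′)) x∈′ added∈
                                      λ x≡added → added∉ (subst (_∈ Φ ⟨ t ⟩) x≡added x∈))

      through : ∀ {p q} → Edge k p q → F p ∈ Φ ⟨ t ⟩ → F q ∈ Φ ⟨ t ⟩ → F p ∈ Φ t′ → F q ∈ Φ t′
              → Σ (MaxTriangleOn k p q new) λ on → Φ (triangleOn on) ≡ Φ t′
      through pq p∈ q∈ p∈′ q∈′ =
        spanned-iset (Φ-indepDom t′) (∣Φ∣≤3 t′) p∈′ q∈′ (subst (_∈ Φ t′) (sym (F-toℕ added)) added∈) pq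
          (kept∼added (proj₁ (adjacent-labels (inj₁ pq))) p∈ p∈′) (kept∼added (edge-label pq) q∈ q∈′)

      keep : ∀ {x y} → F x ∈ Φ ⟨ t ⟩ → F y ≡ removed → F x ≢ F y → F x ∈ Φ t′
      keep x∈ e x≢y = kept x∈ λ x≡ → x≢y (trans x≡ (sym e))

      Fa∈ : F a ∈ Φ ⟨ t ⟩
      Fa∈ = ∈-triple⁺ (inj₁ refl)
      Fb∈ : F b ∈ Φ ⟨ t ⟩
      Fb∈ = ∈-triple⁺ (inj₂ (inj₁ refl))
      Fc∈ : F c ∈ Φ ⟨ t ⟩
      Fc∈ = ∈-triple⁺ (inj₂ (inj₂ refl))
      Fa≢Fb = ∼⇒≢ (∼-F (inj₁ ab))
      Fa≢Fc = ∼⇒≢ (∼-F (inj₁ ac))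
      Fb≢Fc = ∼⇒≢ (∼-F (inj₁ bc))

      removedOneOf : OneOf removed (F a) (F b) (F c) → Neighbours ⟨ t ⟩ t′
      removedOneOf (inj₁ e) =
        let on , eq = through bc Fb∈ Fc∈ (keep Fb∈ (sym e) (Fa≢Fb ∘ sym)) (keep Fc∈ (sym e) (Fa≢Fc ∘ sym))
        in conclude on eq Fa∈ (replace-first t on)
      removedOneOf (inj₂ (inj₁ e)) =
        let on , eq = through ac Fa∈ Fc∈ (keep Fa∈ (sym e) Fa≢Fb) (keep Fc∈ (sym e) (Fb≢Fc ∘ sym))
        in conclude on eq Fb∈ (replace-middle t on)
      removedOneOf (inj₂ (inj₂ e)) =
        let on , eq = through ab Fa∈ Fb∈ (keep Fa∈ (sym e) Fa≢Fc) (keep Fb∈ (sym e) Fb≢Fc)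
        in conclude on eq Fc∈ (replace-last t on)

    neighbours : Neighbours ⟨ t ⟩ t′
    neighbours = removedOneOf (∈-triple⁻ removed∈)

  swap⇒neighbours : ∀ t t′ → ISwap G (Φ t) (Φ t′) → Neighbours t t′
  swap⇒neighbours ⟨ t ⟩ t′ = SwapBetween.neighbours t t′

  open Theta₂₂ (4 + k)
  open ThetaCorrespondence k

  φ : Vertex → Subset N
  φ = Φ ∘ triangleAt

  step⇒swaps : ∀ {x y} → Step x y → ISwap G (φ x) (φ y) × ISwap G (φ y) (φ x)
  step⇒swaps = sharedEdge-swaps ∘ next-sharedEdge ∘ step⇒next

  neighbours⇒step : ∀ {x y} → Neighbours (triangleAt x) (triangleAt y) → Step x y ⊎ Step y x
  neighbours⇒step {x} {y} (inj₁ n) = inj₁ (subst₂ Step (position∘triangleAt x) (position∘triangleAt y) (next⇒step n))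
  neighbours⇒step {x} {y} (inj₂ n) = inj₂ (subst₂ Step (position∘triangleAt y) (position∘triangleAt x) (next⇒step n))

  iso : IGraphIso G (θ 2 2 (6 + k))
  iso = IGraphIso-intro φ endA 3
    (Φ-indepDom ∘ triangleAt) (∣Φ∣≤3 ∘ triangleAt) (λ _ → 3≤∣indepDom∣ ∘ findTriangle)
    (λ X X-indepDom ∣X∣≤3 → let t , Φt≡X = onto X X-indepDom ∣X∣≤3 in
      position t , trans (cong Φ (triangleAt∘position t)) Φt≡X)
    (λ x y φx≡φy → trans (sym (position∘triangleAt x))
      (trans (cong position (Φ-injective _ _ φx≡φy)) (position∘triangleAt y)))
    λ x y → mk⇔
      ([ proj₁ ∘ step⇒swaps , proj₂ ∘ step⇒swaps ] ∘ to (edge⇔step x y))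
      (from (edge⇔step x y) ∘ neighbours⇒step ∘ swap⇒neighbours _ _)

mainTheorem16 : ((k : ℕ) → IGraphIso (complement (Gbar-a k)) (θ 2 2 (6 + k)))
    × IGraphIso (complement Gbar-b) (θ 2 2 5)
mainTheorem16 = CaseA.iso , CaseB.iso
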